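{- Let $p$ be a prime and $n,m$ positive integers. For arbitrary integers $a$ and $r$, $$ {\rm ord}_p\bigg(\sum_{k\equiv r\pmod{p-1}}s(n,k)S(k,m)a^k\bigg)\geq{\rm ord}_p(n!)-{\rm ord}_p(m!). $$ Moreover, if $f(x)$ is a (nonzero) polynomial with integer coefficients, then for arbitrary integers $a,r$, $$ {\rm ord}_p\bigg(\sum_{k\equiv r\pmod{p-1}}s(n,k)f(k)a^k\bigg)\geq {\rm ord}_p(n!)-\log_p\binom{n}{l}, $$ where $l=\min\{\deg f,\lfloor n/p\rfloor\}$.
   Context: The (unsigned) Stirling numbers of the first kind $s(n,k)$ are defined by $x(x+1)\cdots(x+n-1)=\sum_{k=0}^n s(n,k)x^k$, and the Stirling numbers of the second kind $S(n,k)$ by $x^n=\sum_{k=0}^n S(n,k)k!\binom{x}{k}$; $s(0,0)=S(0,0)=1$ and $s(n,k)=S(n,k)=0$ for $k>n$ or $k<0$. Sums are over all integers $k$ in the given residue class (finitely many nonzero terms). For a prime $p$ and nonzero integer $a$, ${\rm ord}_p(a)=\sup\{i\in\mathbb{N}: p^i\mid a\}$, with ${\rm ord}_p(0)=\infty$; $\lfloor\cdot\rfloor$ is the floor function. -}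

module Defs where

open import Data.Nat as ℕ using (ℕ; zero; suc; _∸_; _/_)
open import Data.Nat.Divisibility using (_∣_; _∣?_)
open import Data.Integer as ℤ using (ℤ; +_; ∣_∣)
open import Data.List using (List; []; _∷_; upTo; map; foldr)
open import Data.Bool using (Bool; true; false; if_then_else_; _∧_)
open import Relation.Nullary using (¬_)
open import Relation.Nullary.Decidable using (⌊_⌋)
open import Data.Product using (_×_)
open import Relation.Binary.PropositionalEquality using (_≡_)

-- Unsigned Stirling numbers of the first kind, via the recurrence
-- s(n+1,k) = n s(n,k) + s(n,k-1)  (coefficients of x(x+1)...(x+n-1)).
stir1 : ℕ → ℕ → ℕ
stir1 zero    zero    = 1
stir1 zero    (suc k) = 0
stir1 (suc n) zero    = 0
stir1 (suc n) (suc k) = n ℕ.* stir1 n (suc k) ℕ.+ stir1 n k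

stir2 : ℕ → ℕ → ℕ
stir2 zero    zero    = 1
stir2 zero    (suc k) = 0
stir2 (suc n) zero    = 0
stir2 (suc n) (suc k) = suc k ℕ.* stir2 n (suc k) ℕ.+ stir2 n k

-- p-adic order as a relation: IsOrd p x e  iff  ord_p(x) = e  (x ≠ 0).
-- For x = 0 (ord = ∞) there is no such e.
IsOrd : ℕ → ℤ → ℕ → Set
IsOrd p x e = (p ℕ.^ e ∣ ∣ x ∣) × ¬ (p ℕ.^ suc e ∣ ∣ x ∣)

-- Sum over the integers k (all k, but terms with s(n,k) ≠ 0 have 0 ≤ k ≤ n)
-- with k ≡ r (mod q) of g k.
sumRes : (q : ℕ) (r : ℤ) (n : ℕ) (g : ℕ → ℤ) → ℤ
sumRes q r n g =
  foldr ℤ._+_ (+ 0)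
    (map (λ k → if ⌊ q ∣? ∣ (+ k) ℤ.- r ∣ ⌋ then g k else + 0) (upTo (suc n)))

-- Polynomials with integer coefficients: coefficient lists, constant first.
Poly : Set
Poly = List ℤ

eval : Poly → ℤ → ℤ
eval []       x = + 0
eval (c ∷ cs) x = c ℤ.+ x ℤ.* eval cs x

isZeroCoeff : ℤ → Bool
isZeroCoeff (+ zero) = true
isZeroCoeff _        = false

allZero : Poly → Bool
allZero []       = true
allZero (c ∷ cs) = isZeroCoeff c ∧ allZero cs

NonZeroPoly : Poly → Set
NonZeroPoly f = allZero f ≡ false

-- degree = index of the highest nonzero coefficient (0 for the zero polynomial)
deg : Poly → ℕ
deg []       = 0
deg (c ∷ cs) = if allZero cs then 0 else suc (deg cs)

-- floor division (divisor 0 gives 0; only used with a prime divisor)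
quot : ℕ → ℕ → ℕ
quot n zero    = 0
quot n (suc q) = n / suc q

{-# OPTIONS --safe #-}
module Submission where

-- For the first part, m! Σₖ s(n,k) S(k,m) yᵏ is the m-th finite difference at 0 of
-- x ↦ xy (xy + 1) ⋯ (xy + n − 1), and n! divides every value of this rising factorial, hence
-- every finite difference of it.
--
-- For the second part, write f in the basis k (k − 1) ⋯ (k − i + 1), i ≤ deg f. The sum
-- Σₖ s(n,k) k(k−1)⋯(k−i+1) yᵏ is i! yⁱ times a sum of products of n − i of the factors y + j,
-- j < n, and each such product misses at most i of the multiples of pᵗ among these factors; so it
-- is divisible by p^(ord_p(i!) + Σₜ max(⌊n/pᵗ⌋ − i, 0)). By Legendre's formula it remains to see
-- p^(Σₜ min(⌊n/pᵗ⌋, i)) ≤ C(n,i) p^ord_p(i!), which follows by comparing the product of the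
-- distinct numbers pᵗ·u_j ≤ n (u_j the prime-to-p part of j, t maximal) for j ≤ i with
-- n(n − 1)⋯(n − i + 1).
--
-- In both parts, divisibility of Σₖ cₖ yᵏ for all integers y passes to the sum over k ≡ r
-- (mod p − 1) by substituting y = a·b^(p^N) for the units b modulo p and summing: Σ_b b^(p^N·J)
-- is ≡ p − 1 or ≡ 0 modulo p^(N+1) according as p − 1 divides J or not.

open import Defs
open import Algebra.Bundles using (CommutativeMonoid)
open import Data.Nat as ℕ using (ℕ; zero; suc; _<_; _≤_; z≤n; s≤s)
import Data.Nat.Properties as ℕ
import Data.Nat.Divisibility as ℕ
open import Data.Nat.Primality using (Prime; euclidsLemma; ¬prime[0]; ¬prime[1])
open import Data.Nat.DivMod using (m≡m%n+[m/n]*n; m%n<n)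
open import Data.Integer as ℤ using (ℤ; +_; 0ℤ; 1ℤ; -[1+_])
import Data.Integer.Properties as ℤ
open import Data.Integer.Tactic.RingSolver using (solve-∀)
open import Data.Nat.Tactic.RingSolver using () renaming (solve-∀ to ℕ-solve-∀)
open import Relation.Binary.PropositionalEquality as ≡ using (_≡_; _≢_; cong)
open import Relation.Binary.Bundles using (Setoid)
import Relation.Binary.Reasoning.Setoid
open import Relation.Binary.Definitions using (tri<; tri≈; tri>)
open import Relation.Nullary using (¬_; yes; no; Dec; contradiction)
open import Data.Sum using (_⊎_; inj₁; inj₂; [_,_]′)
open import Data.Product using (_×_; _,_; proj₁; proj₂; ∃)
open import Data.Bool using (true; false)
open import Data.Empty using (⊥-elim)
open import Function using (_∘_; id)
open import Function.Bundles using (_⇔_; mk⇔; Equivalence)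

-- Sums and products over initial segments of ℕ

module RangeFold {c ℓ} (M : CommutativeMonoid c ℓ) where

  open CommutativeMonoid M
  open import Relation.Binary.Reasoning.Setoid setoid

  fold : ℕ → (ℕ → Carrier) → Carrier
  fold zero    f = ε
  fold (suc n) f = fold n f ∙ f n

  fold-cong : ∀ n {f g} → (∀ k → k < n → f k ≈ g k) → fold n f ≈ fold n g
  fold-cong zero    f≈g = refl
  fold-cong (suc n) f≈g = ∙-cong (fold-cong n (λ k k<n → f≈g k (ℕ.m<n⇒m<1+n k<n))) (f≈g n ℕ.≤-refl)

  fold-ε : ∀ n {f} → (∀ k → k < n → f k ≈ ε) → fold n f ≈ ε
  fold-ε zero    f≈ε = refl
  fold-ε (suc n) f≈ε = begin
    fold n _ ∙ _  ≈⟨ ∙-cong (fold-ε n (λ k k<n → f≈ε k (ℕ.m<n⇒m<1+n k<n))) (f≈ε n ℕ.≤-refl) ⟩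
    ε ∙ ε         ≈⟨ identityˡ ε ⟩
    ε             ∎

  fold-merge : ∀ n (f g : ℕ → Carrier) → fold n (λ k → f k ∙ g k) ≈ fold n f ∙ fold n g
  fold-merge zero    f g = sym (identityˡ ε)
  fold-merge (suc n) f g = begin
    fold n (λ k → f k ∙ g k) ∙ (f n ∙ g n)  ≈⟨ ∙-congʳ (fold-merge n f g) ⟩
    (fold n f ∙ fold n g) ∙ (f n ∙ g n)     ≈⟨ interchange (fold n f) (fold n g) (f n) (g n) ⟩
    fold (suc n) f ∙ fold (suc n) g         ∎
    where open import Algebra.Properties.CommutativeSemigroup commutativeSemigroup using (interchange)

  fold-comm : ∀ m n (f : ℕ → ℕ → Carrier) →
              fold m (λ i → fold n (f i)) ≈ fold n (λ j → fold m (λ i → f i j))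
  fold-comm zero    n f = sym (fold-ε n (λ _ _ → refl))
  fold-comm (suc m) n f = begin
    fold m (λ i → fold n (f i)) ∙ fold n (f m)          ≈⟨ ∙-congʳ (fold-comm m n f) ⟩
    fold n (λ j → fold m (λ i → f i j)) ∙ fold n (f m)  ≈⟨ sym (fold-merge n _ (f m)) ⟩
    fold n (λ j → fold (suc m) (λ i → f i j))           ∎

  fold-head : ∀ n (f : ℕ → Carrier) → fold (suc n) f ≈ f 0 ∙ fold n (f ∘ suc)
  fold-head zero    f = trans (identityˡ (f 0)) (sym (identityʳ (f 0)))
  fold-head (suc n) f = trans (∙-congʳ (fold-head n f)) (assoc (f 0) _ _)

  fold-split : ∀ m n (f : ℕ → Carrier) → fold (m ℕ.+ n) f ≈ fold m f ∙ fold n (λ k → f (m ℕ.+ k))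
  fold-split m zero    f = begin
    fold (m ℕ.+ 0) f  ≡⟨ cong (λ l → fold l f) (ℕ.+-identityʳ m) ⟩
    fold m f          ≈⟨ identityʳ _ ⟨
    fold m f ∙ ε      ∎
  fold-split m (suc n) f = begin
    fold (m ℕ.+ suc n) f                                   ≡⟨ cong (λ l → fold l f) (ℕ.+-suc m n) ⟩
    fold (m ℕ.+ n) f ∙ f (m ℕ.+ n)                         ≈⟨ ∙-congʳ (fold-split m n f) ⟩
    (fold m f ∙ fold n (λ k → f (m ℕ.+ k))) ∙ f (m ℕ.+ n)  ≈⟨ assoc _ _ _ ⟩
    fold m f ∙ fold (suc n) (λ k → f (m ℕ.+ k))            ∎

  select : ℕ → ℕ → Carrier → Carrier
  select x y v with x ℕ.≟ y
  ... | yes _ = v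
  ... | no  _ = ε

  select-≢ : ∀ {x y} v → x ≢ y → select x y v ≈ ε
  select-≢ {x} {y} v x≢y with x ℕ.≟ y
  ... | yes x≡y = contradiction x≡y x≢y
  ... | no  _   = refl

  select-≡ : ∀ x v → select x x v ≈ v
  select-≡ x v with x ℕ.≟ x
  ... | yes _   = refl
  ... | no  x≢x = contradiction ≡.refl x≢x

  select-cong : ∀ {x y x′ y′} v → (x ≡ y → x′ ≡ y′) → (x′ ≡ y′ → x ≡ y) → select x y v ≈ select x′ y′ v
  select-cong {x} {y} {x′} {y′} v to from with x ℕ.≟ y | x′ ℕ.≟ y′
  ... | yes _ | yes _ = refl
  ... | no  _ | no  _ = refl
  ... | yes e | no ne = contradiction (to e) ne
  ... | no ne | yes e = contradiction (from e) ne

  fold-select : ∀ n {y} (g : ℕ → Carrier) → y < n → fold n (λ x → select x y (g x)) ≈ g y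
  fold-select (suc n) {y} g y<1+n with ℕ.m<1+n⇒m<n∨m≡n y<1+n
  ... | inj₁ y<n = begin
    fold n (λ x → select x y (g x)) ∙ select n y (g n)  ≈⟨ ∙-cong (fold-select n g y<n) (select-≢ (g n) (ℕ.>⇒≢ y<n)) ⟩
    g y ∙ ε                                             ≈⟨ identityʳ (g y) ⟩
    g y                                                 ∎
  ... | inj₂ ≡.refl = begin
    fold n (λ x → select x n (g x)) ∙ select n n (g n)  ≈⟨ ∙-cong (fold-ε n (λ x x<n → select-≢ (g x) (ℕ.<⇒≢ x<n))) (select-≡ n (g n)) ⟩
    ε ∙ g n                                             ≈⟨ identityˡ (g n) ⟩
    g n                                                 ∎

  fold-reindex : ∀ n (π σ : ℕ → ℕ) → (∀ x → x < n → π x < n) → (∀ x → x < n → σ x < n) →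
                 (∀ x → x < n → σ (π x) ≡ x) → (∀ x → x < n → π (σ x) ≡ x) →
                 ∀ (h : ℕ → Carrier) → fold n (h ∘ π) ≈ fold n h
  fold-reindex n π σ π< σ< σπ πσ h = begin
    fold n (h ∘ π)                                      ≈⟨ fold-cong n (λ b b<n → sym (fold-select n h (π< b b<n))) ⟩
    fold n (λ b → fold n (λ x → select x (π b) (h x)))  ≈⟨ fold-comm n n _ ⟩
    fold n (λ x → fold n (λ b → select x (π b) (h x)))  ≈⟨ fold-cong n (λ x x<n → fold-cong n (λ b b<n →
                                                                   select-cong (h x) (to x<n b<n) (from x<n b<n))) ⟩
    fold n (λ x → fold n (λ b → select b (σ x) (h x)))  ≈⟨ fold-cong n (λ x x<n → fold-select n (λ _ → h x) (σ< x x<n)) ⟩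
    fold n h                                            ∎
    where
    to : ∀ {x b} → x < n → b < n → x ≡ π b → b ≡ σ x
    to {b = b} _ b<n ≡.refl = ≡.sym (σπ b b<n)
    from : ∀ {x b} → x < n → b < n → b ≡ σ x → x ≡ π b
    from {x} x<n _ ≡.refl = ≡.sym (πσ x x<n)

open import Relation.Binary.PropositionalEquality hiding (J)

module Sumℤ = RangeFold ℤ.+-0-commutativeMonoid
open Sumℤ using () renaming
  (fold to ∑; fold-cong to ∑-cong; fold-merge to ∑-distrib-+; fold-comm to ∑-comm; fold-head to ∑-head;
   fold-reindex to ∑-reindex)

module Sumℕ = RangeFold ℕ.+-0-commutativeMonoid
open Sumℕ using () renaming
  (fold to ∑ℕ; fold-cong to ∑ℕ-cong; fold-ε to ∑ℕ-zero; fold-merge to ∑ℕ-distrib-+; fold-comm to ∑ℕ-comm;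
   fold-split to ∑ℕ-split)

module Productℕ = RangeFold ℕ.*-1-commutativeMonoid
open Productℕ using () renaming (fold to ∏; fold-merge to ∏-distrib-*; fold-head to ∏-head)

-- Integer divisibility and congruences

module _ where
  open import Data.Integer using (_+_; _*_; -_; _-_; _^_)
  open import Data.Integer.Divisibility.Signed
    using (_∣_; divides; ∣-trans; ∣ᵤ⇒∣; ∣⇒∣ᵤ; ∣m∣n⇒∣m+n; ∣m⇒∣-m; ∣n⇒∣m*n; ∣m⇒∣m*n)
  open ≡-Reasoning

  *-distribˡ-∑ : ∀ n c (f : ℕ → ℤ) → ∑ n (λ k → c * f k) ≡ c * ∑ n f
  *-distribˡ-∑ zero    c f = sym (ℤ.*-zeroʳ c)
  *-distribˡ-∑ (suc n) c f = begin
    ∑ n (λ k → c * f k) + c * f n  ≡⟨ cong (_+ c * f n) (*-distribˡ-∑ n c f) ⟩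
    c * ∑ n f + c * f n            ≡⟨ ℤ.*-distribˡ-+ c (∑ n f) (f n) ⟨
    c * ∑ (suc n) f                ∎

  *-distribʳ-∑ : ∀ n c (f : ℕ → ℤ) → ∑ n f * c ≡ ∑ n (λ k → f k * c)
  *-distribʳ-∑ n c f = begin
    ∑ n f * c            ≡⟨ ℤ.*-comm (∑ n f) c ⟩
    c * ∑ n f            ≡⟨ *-distribˡ-∑ n c f ⟨
    ∑ n (λ k → c * f k)  ≡⟨ ∑-cong n (λ k _ → ℤ.*-comm c (f k)) ⟩
    ∑ n (λ k → f k * c)  ∎

  ∑-const : ∀ n c → ∑ n (λ _ → c) ≡ + n * c
  ∑-const zero    c = sym (ℤ.*-zeroˡ c)
  ∑-const (suc n) c = begin
    ∑ n (λ _ → c) + c  ≡⟨ cong (_+ c) (∑-const n c) ⟩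
    + n * c + c        ≡⟨ lemma (+ n) c ⟩
    + suc n * c        ∎
    where
    lemma : ∀ n c → n * c + c ≡ (1ℤ + n) * c
    lemma = solve-∀

  ∑-telescope : ∀ n (F : ℕ → ℤ) → ∑ n (λ b → F (suc b) - F b) ≡ F n - F 0
  ∑-telescope zero    F = sym (ℤ.+-inverseʳ (F 0))
  ∑-telescope (suc n) F = trans (cong (_+ (F (suc n) - F n)) (∑-telescope n F)) (lemma (F n) (F 0) (F (suc n)))
    where
    lemma : ∀ a b c → (a - b) + (c - a) ≡ c - b
    lemma = solve-∀

  *-pres-∣ : ∀ {a b x y} → a ∣ x → b ∣ y → a * b ∣ x * y
  *-pres-∣ {a} {b} (divides s refl) (divides t refl) = divides (s * t) (lemma s t a b)
    where
    lemma : ∀ s t a b → s * a * (t * b) ≡ s * t * (a * b)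
    lemma = solve-∀

  ∣-respʳ : ∀ {d x y} → x ≡ y → d ∣ x → d ∣ y
  ∣-respʳ refl d∣x = d∣x

  ∣-∑ : ∀ {d} n (f : ℕ → ℤ) → (∀ k → k < n → d ∣ f k) → d ∣ ∑ n f
  ∣-∑ zero    f d∣f = divides 0ℤ refl
  ∣-∑ (suc n) f d∣f = ∣m∣n⇒∣m+n (∣-∑ n f (λ k k<n → d∣f k (ℕ.m<n⇒m<1+n k<n))) (d∣f n ℕ.≤-refl)

  pos-^ : ∀ a n → + (a ℕ.^ n) ≡ (+ a) ^ n
  pos-^ a zero    = refl
  pos-^ a (suc n) = trans (ℤ.pos-* a (a ℕ.^ n)) (cong (+ a *_) (pos-^ a n))

  ^-distribʳ-* : ∀ (x y : ℤ) n → (x * y) ^ n ≡ x ^ n * y ^ n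
  ^-distribʳ-* x y zero    = refl
  ^-distribʳ-* x y (suc n) = trans (cong (x * y *_) (^-distribʳ-* x y n)) (lemma x y (x ^ n) (y ^ n))
    where
    lemma : ∀ x y a b → x * y * (a * b) ≡ x * a * (y * b)
    lemma = solve-∀

  infix 4 _≡_mod_

  record _≡_mod_ (x y : ℤ) (d : ℕ) : Set where
    constructor mod-by
    field divides-difference : + d ∣ x - y

  open _≡_mod_ public

  module _ {d : ℕ} where

    ≡-mod-reflexive : ∀ {x y} → x ≡ y → x ≡ y mod d
    ≡-mod-reflexive {x} refl = mod-by (divides 0ℤ (ℤ.+-inverseʳ x))

    ≡-mod-sym : ∀ {x y} → x ≡ y mod d → y ≡ x mod d
    ≡-mod-sym {x} {y} (mod-by d∣x-y) = mod-by (subst (+ d ∣_) (lemma x y) (∣m⇒∣-m d∣x-y))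
      where
      lemma : ∀ x y → - (x - y) ≡ y - x
      lemma = solve-∀

    ≡-mod-trans : ∀ {x y z} → x ≡ y mod d → y ≡ z mod d → x ≡ z mod d
    ≡-mod-trans {x} {y} {z} (mod-by d∣x-y) (mod-by d∣y-z) =
      mod-by (subst (+ d ∣_) (ℤ.+-minus-telescope x y z) (∣m∣n⇒∣m+n d∣x-y d∣y-z))

    ≡-mod-setoid : Setoid _ _
    ≡-mod-setoid = record
      { Carrier = ℤ ; _≈_ = _≡_mod d
      ; isEquivalence = record { refl = ≡-mod-reflexive refl ; sym = ≡-mod-sym ; trans = ≡-mod-trans } }

    +-cong-mod : ∀ {x y u v} → x ≡ y mod d → u ≡ v mod d → x + u ≡ y + v mod d
    +-cong-mod {x} {y} {u} {v} (mod-by h₁) (mod-by h₂) = mod-by (subst (+ d ∣_) (lemma x y u v) (∣m∣n⇒∣m+n h₁ h₂))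
      where
      lemma : ∀ x y u v → (x - y) + (u - v) ≡ (x + u) - (y + v)
      lemma = solve-∀

    *-cong-mod : ∀ {x y u v} → x ≡ y mod d → u ≡ v mod d → x * u ≡ y * v mod d
    *-cong-mod {x} {y} {u} {v} (mod-by h₁) (mod-by h₂) =
      mod-by (subst (+ d ∣_) (lemma x y u v) (∣m∣n⇒∣m+n (∣m⇒∣m*n u h₁) (∣n⇒∣m*n y h₂)))
      where
      lemma : ∀ x y u v → (x - y) * u + y * (u - v) ≡ x * u - y * v
      lemma = solve-∀

    ^-cong-mod : ∀ {x y} n → x ≡ y mod d → x ^ n ≡ y ^ n mod d
    ^-cong-mod zero    x≡y = ≡-mod-reflexive refl
    ^-cong-mod (suc n) x≡y = *-cong-mod x≡y (^-cong-mod n x≡y)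

    ∑-cong-mod : ∀ n {f g : ℕ → ℤ} → (∀ k → k < n → f k ≡ g k mod d) → ∑ n f ≡ ∑ n g mod d
    ∑-cong-mod zero    f≡g = ≡-mod-reflexive refl
    ∑-cong-mod (suc n) f≡g = +-cong-mod (∑-cong-mod n (λ k k<n → f≡g k (ℕ.m<n⇒m<1+n k<n))) (f≡g n ℕ.≤-refl)

    ∣⇒≡0-mod : ∀ {x} → + d ∣ x → x ≡ 0ℤ mod d
    ∣⇒≡0-mod {x} d∣x = mod-by (subst (+ d ∣_) (sym (ℤ.+-identityʳ x)) d∣x)

    ∣-resp-≡-mod : ∀ {x y} → x ≡ y mod d → + d ∣ y → + d ∣ x
    ∣-resp-≡-mod {x} {y} (mod-by d∣x-y) d∣y = subst (+ d ∣_) (lemma x y) (∣m∣n⇒∣m+n d∣x-y d∣y)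
      where
      lemma : ∀ x y → (x - y) + y ≡ x
      lemma = solve-∀

  module ≡-mod-Reasoning (d : ℕ) = Relation.Binary.Reasoning.Setoid (≡-mod-setoid {d})

  ≡-mod-∣ : ∀ {d e x y} → d ℕ.∣ e → x ≡ y mod e → x ≡ y mod d
  ≡-mod-∣ d∣e (mod-by e∣x-y) = mod-by (∣-trans (∣ᵤ⇒∣ d∣e) e∣x-y)

module _ where
  open import Data.Nat using (_*_; _^_)

  ∑ℕ-mono : ∀ n {f g : ℕ → ℕ} → (∀ k → k < n → f k ≤ g k) → ∑ℕ n f ≤ ∑ℕ n g
  ∑ℕ-mono zero    f≤g = z≤n
  ∑ℕ-mono (suc n) f≤g = ℕ.+-mono-≤ (∑ℕ-mono n (λ k k<n → f≤g k (ℕ.m<n⇒m<1+n k<n))) (f≤g n ℕ.≤-refl)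

  ∏-^ : ∀ a n (f : ℕ → ℕ) → ∏ n (λ k → a ^ f k) ≡ a ^ ∑ℕ n f
  ∏-^ a zero    f = refl
  ∏-^ a (suc n) f = trans (cong (_* a ^ f n) (∏-^ a n f)) (sym (ℕ.^-distribˡ-+-* a (∑ℕ n f) (f n)))

-- Falling factorials, binomial coefficients and sums of powers

module _ where
  open import Data.Nat using (_+_; _*_; _∸_; _!)
  open import Data.Nat.Combinatorics using (_C_; nCk+nC[k+1]≡[n+1]C[k+1])
  open import Data.Nat.Properties using (_!≢0)
  open ≡-Reasoning

  infixl 7 _↓_

  _↓_ : ℕ → ℕ → ℕ
  k     ↓ zero  = 1
  zero  ↓ suc i = 0
  suc k ↓ suc i = suc k * (k ↓ i)

  ↓-suc : ∀ k i → k ↓ suc i + i * (k ↓ i) ≡ k * (k ↓ i)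
  ↓-suc zero    zero    = refl
  ↓-suc zero    (suc i) = ℕ.*-zeroʳ (suc i)
  ↓-suc (suc k) zero    = ℕ.+-identityʳ (suc k * 1)
  ↓-suc (suc k) (suc i) = begin
    suc k * G + suc i * (suc k * F)  ≡⟨ lemma₁ k F G i ⟩
    suc k * (G + i * F) + suc k * F  ≡⟨ cong (λ t → suc k * t + suc k * F) (↓-suc k i) ⟩
    suc k * (k * F) + suc k * F      ≡⟨ lemma₂ k F ⟩
    suc k * (suc k * F)              ∎
    where
    F = k ↓ i
    G = k ↓ suc i
    lemma₁ : ∀ k F G i → (1 + k) * G + (1 + i) * ((1 + k) * F) ≡ (1 + k) * (G + i * F) + (1 + k) * F
    lemma₁ = ℕ-solve-∀
    lemma₂ : ∀ k F → (1 + k) * (k * F) + (1 + k) * F ≡ (1 + k) * ((1 + k) * F)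
    lemma₂ = ℕ-solve-∀

  ↓-pascal : ∀ k i → suc k ↓ suc i ≡ k ↓ suc i + suc i * (k ↓ i)
  ↓-pascal k i = begin
    suc k * (k ↓ i)                    ≡⟨ cong (λ t → k ↓ i + t) (↓-suc k i) ⟨
    k ↓ i + (k ↓ suc i + i * (k ↓ i))  ≡⟨ lemma (k ↓ i) (k ↓ suc i) i ⟩
    k ↓ suc i + suc i * (k ↓ i)        ∎
    where
    lemma : ∀ f g i → f + (g + i * f) ≡ g + (1 + i) * f
    lemma = ℕ-solve-∀

  ↓≡C*! : ∀ n i → n ↓ i ≡ (n C i) * i !
  ↓≡C*! n       zero    = refl
  ↓≡C*! zero    (suc i) = refl
  ↓≡C*! (suc n) (suc i) = begin
    suc n * F                                          ≡⟨ cong (λ t → F + t) (↓-suc n i) ⟨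
    F + (G + i * F)                                    ≡⟨ lemma₁ F G i ⟩
    suc i * F + G                                      ≡⟨ cong₂ (λ s t → suc i * s + t) (↓≡C*! n i) (↓≡C*! n (suc i)) ⟩
    suc i * ((n C i) * i !) + (n C suc i) * (suc i) !  ≡⟨ lemma₂ (n C i) (n C suc i) i (i !) ⟩
    ((n C i) + (n C suc i)) * (suc i) !                ≡⟨ cong (_* (suc i) !) (nCk+nC[k+1]≡[n+1]C[k+1] n i) ⟩
    (suc n C suc i) * (suc i) !                        ∎
    where
    F = n ↓ i
    G = n ↓ suc i
    lemma₁ : ∀ F G i → F + (G + i * F) ≡ (1 + i) * F + G
    lemma₁ = ℕ-solve-∀
    lemma₂ : ∀ a b i f → (1 + i) * (a * f) + b * ((1 + i) * f) ≡ (a + b) * ((1 + i) * f)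
    lemma₂ = ℕ-solve-∀

  ↓-monoˡ-≤ : ∀ n i → n ↓ i ≤ suc n ↓ i
  ↓-monoˡ-≤ n       zero    = ℕ.≤-refl
  ↓-monoˡ-≤ zero    (suc i) = z≤n
  ↓-monoˡ-≤ (suc n) (suc i) = ℕ.*-mono-≤ (ℕ.n≤1+n (suc n)) (↓-monoˡ-≤ n i)

  ↓-suc-∸ : ∀ n i → n ↓ suc i ≡ (n ∸ i) * (n ↓ i)
  ↓-suc-∸ n i = begin
    n ↓ suc i                              ≡⟨ ℕ.m+n∸n≡m (n ↓ suc i) (i * (n ↓ i)) ⟨
    n ↓ suc i + i * (n ↓ i) ∸ i * (n ↓ i)  ≡⟨ cong (_∸ i * (n ↓ i)) (↓-suc n i) ⟩
    n * (n ↓ i) ∸ i * (n ↓ i)              ≡⟨ ℕ.*-distribʳ-∸ (n ↓ i) n i ⟨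
    (n ∸ i) * (n ↓ i)                      ∎

  C-suc : ∀ n i → (n C suc i) * suc i ≡ (n C i) * (n ∸ i)
  C-suc n i = ℕ.*-cancelʳ-≡ _ _ (i !) {{i !≢0}} (begin
    (n C suc i) * suc i * i !  ≡⟨ ℕ.*-assoc (n C suc i) (suc i) (i !) ⟩
    (n C suc i) * (suc i) !    ≡⟨ ↓≡C*! n (suc i) ⟨
    n ↓ suc i                  ≡⟨ ↓-suc-∸ n i ⟩
    (n ∸ i) * (n ↓ i)          ≡⟨ cong ((n ∸ i) *_) (↓≡C*! n i) ⟩
    (n ∸ i) * ((n C i) * i !)  ≡⟨ lemma (n ∸ i) (n C i) (i !) ⟩
    (n C i) * (n ∸ i) * i !     ∎)
    where
    lemma : ∀ a b c → a * (b * c) ≡ b * a * c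
    lemma = ℕ-solve-∀

  C-monoʳ-≤-below-half : ∀ n {i l} → i ≤ l → 2 * l ≤ n → n C i ≤ n C l
  C-monoʳ-≤-below-half n {i} {zero}  z≤n  _ = ℕ.≤-refl
  C-monoʳ-≤-below-half n {i} {suc l} i≤1+l 2[1+l]≤n with ℕ.m≤n⇒m<n∨m≡n i≤1+l
  ... | inj₂ refl = ℕ.≤-refl
  ... | inj₁ i<1+l = ℕ.≤-trans (C-monoʳ-≤-below-half n (ℕ.≤-pred i<1+l) 2l≤n) (ℕ.*-cancelʳ-≤ _ _ (suc l) step)
    where
    2l≤n : 2 * l ≤ n
    2l≤n = ℕ.≤-trans (ℕ.*-monoʳ-≤ 2 (ℕ.n≤1+n l)) 2[1+l]≤n
    1+l≤n∸l : suc l ≤ n ∸ l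
    1+l≤n∸l = ℕ.m+n≤o⇒m≤o∸n (suc l) (ℕ.≤-trans (ℕ.n≤1+n _) (ℕ.≤-trans (ℕ.≤-reflexive (lemma l)) 2[1+l]≤n))
      where
      lemma : ∀ l → 2 + l + l ≡ 2 * (1 + l)
      lemma = ℕ-solve-∀
    step : (n C l) * suc l ≤ (n C suc l) * suc l
    step = ℕ.≤-trans (ℕ.*-monoʳ-≤ (n C l) 1+l≤n∸l) (ℕ.≤-reflexive (sym (C-suc n l)))

module _ where
  open import Data.Integer using (_+_; _*_; _^_)
  open import Data.Nat.Combinatorics using (_C_; nCk+nC[k+1]≡[n+1]C[k+1])
  open import Data.Nat.Combinatorics.Specification using (k>n⇒nCk≡0)
  open ≡-Reasoning

  binomial : ∀ (x : ℤ) n → (x + 1ℤ) ^ n ≡ ∑ (suc n) (λ i → + (n C i) * x ^ i)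
  binomial x zero    = refl
  binomial x (suc n) = sym (begin
    ∑ (suc (suc n)) (λ i → + (suc n C i) * x ^ i)           ≡⟨ ∑-head (suc n) _ ⟩
    1ℤ + ∑ (suc n) (λ i → + (suc n C suc i) * x ^ suc i)    ≡⟨ cong (λ t → 1ℤ + t) (∑-cong (suc n) (λ i _ → pascal i)) ⟩
    1ℤ + ∑ (suc n) (λ i → x * g i + g (suc i))              ≡⟨ cong (λ t → 1ℤ + t) (∑-distrib-+ (suc n) _ _) ⟩
    1ℤ + (∑ (suc n) (λ i → x * g i) + ∑ (suc n) (g ∘ suc))  ≡⟨ cong (λ t → 1ℤ + (t + ∑ (suc n) (g ∘ suc))) (*-distribˡ-∑ (suc n) x g) ⟩
    1ℤ + (x * S + ∑ (suc n) (g ∘ suc))                      ≡⟨ lemma₁ (x * S) (∑ (suc n) (g ∘ suc)) ⟩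
    x * S + (g 0 + ∑ (suc n) (g ∘ suc))                     ≡⟨ cong (λ t → x * S + t) (∑-head (suc n) g) ⟨
    x * S + ∑ (suc (suc n)) g                               ≡⟨ cong (λ t → x * S + (S + t * x ^ suc n)) (cong +_ (k>n⇒nCk≡0 {n} ℕ.≤-refl)) ⟩
    x * S + (S + 0ℤ * x ^ suc n)                            ≡⟨ lemma₂ x S (x ^ suc n) ⟩
    (x + 1ℤ) * S                                            ≡⟨ cong ((x + 1ℤ) *_) (binomial x n) ⟨
    (x + 1ℤ) ^ suc n                                       ∎)
    where
    g : ℕ → ℤ
    g i = + (n C i) * x ^ i
    S = ∑ (suc n) g
    pascal : ∀ i → + (suc n C suc i) * x ^ suc i ≡ x * g i + g (suc i)
    pascal i = begin
      + (suc n C suc i) * x ^ suc i              ≡⟨ cong (λ c → + c * x ^ suc i) (nCk+nC[k+1]≡[n+1]C[k+1] n i) ⟨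
      + (n C i ℕ.+ n C suc i) * x ^ suc i        ≡⟨ cong (_* x ^ suc i) (ℤ.pos-+ (n C i) (n C suc i)) ⟩
      (+ (n C i) + + (n C suc i)) * (x * x ^ i)  ≡⟨ lemma (+ (n C i)) (+ (n C suc i)) x (x ^ i) ⟩
      x * g i + g (suc i)                        ∎
      where
      lemma : ∀ a b x y → (a + b) * (x * y) ≡ x * (a * y) + b * (x * y)
      lemma = solve-∀
    lemma₁ : ∀ a b → 1ℤ + (a + b) ≡ a + (1ℤ + b)
    lemma₁ = solve-∀
    lemma₂ : ∀ x s y → x * s + (s + 0ℤ * y) ≡ (x + 1ℤ) * s
    lemma₂ = solve-∀

module _ where
  open import Data.Integer using (_+_; _*_; -_; _-_; _^_)
  open import Data.Integer.Divisibility.Signed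
    using (_∣_; divides; ∣-trans; ∣ᵤ⇒∣; ∣⇒∣ᵤ; ∣m∣n⇒∣m+n; ∣m⇒∣-m; ∣n⇒∣m*n; ∣m⇒∣m*n)

  geomSum : ℤ → ℤ → ℕ → ℤ
  geomSum x y zero    = 0ℤ
  geomSum x y (suc n) = x ^ n + y * geomSum x y n

  ^-minus-^ : ∀ x y n → x ^ n - y ^ n ≡ (x - y) * geomSum x y n
  ^-minus-^ x y zero    = trans (ℤ.+-inverseʳ 1ℤ) (sym (ℤ.*-zeroʳ (x - y)))
  ^-minus-^ x y (suc n) = begin
    x * x ^ n - y * y ^ n                            ≡⟨ lemma₁ x y (x ^ n) (y ^ n) ⟩
    (x - y) * x ^ n + y * (x ^ n - y ^ n)            ≡⟨ cong (λ t → (x - y) * x ^ n + y * t) (^-minus-^ x y n) ⟩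
    (x - y) * x ^ n + y * ((x - y) * geomSum x y n)  ≡⟨ lemma₂ x y (x ^ n) (geomSum x y n) ⟩
    (x - y) * geomSum x y (suc n)                    ∎
    where
    open ≡-Reasoning
    lemma₁ : ∀ x y a b → x * a - y * b ≡ (x - y) * a + y * (a - b)
    lemma₁ = solve-∀
    lemma₂ : ∀ x y a g → (x - y) * a + y * ((x - y) * g) ≡ (x - y) * (a + y * g)
    lemma₂ = solve-∀

  geomSum-≡-mod : ∀ {d x y} → x ≡ y mod d → ∀ n → geomSum x y (suc n) ≡ + suc n * y ^ n mod d
  geomSum-≡-mod {d} {x} {y} x≡y zero    = ≡-mod-reflexive (lemma y)
    where
    lemma : ∀ y → 1ℤ + y * 0ℤ ≡ 1ℤ * 1ℤ
    lemma = solve-∀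
  geomSum-≡-mod {d} {x} {y} x≡y (suc n) = begin
    x ^ suc n + y * geomSum x y (suc n)  ≈⟨ +-cong-mod (^-cong-mod (suc n) x≡y) (*-cong-mod (≡-mod-reflexive {x = y} refl) (geomSum-≡-mod x≡y n)) ⟩
    y ^ suc n + y * (+ suc n * y ^ n)    ≡⟨ lemma y (y ^ n) (+ suc n) ⟩
    + suc (suc n) * y ^ suc n            ∎
    where
    open ≡-mod-Reasoning d
    lemma : ∀ y a m → y * a + y * (m * a) ≡ (1ℤ + m) * (y * a)
    lemma = solve-∀

  ^-lift-≡-mod : ∀ {p m x y} → p ℕ.∣ m → x ≡ y mod m → x ^ p ≡ y ^ p mod (p ℕ.* m)
  ^-lift-≡-mod {zero}  {m} {x} {y} _   _   = ≡-mod-reflexive refl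
  ^-lift-≡-mod {suc k} {m} {x} {y} p∣m x≡y = mod-by (subst (_ ∣_) (sym (^-minus-^ x y (suc k)))
    (subst (_∣ _) (trans (sym (ℤ.pos-* m (suc k))) (cong +_ (ℕ.*-comm m (suc k)))) (*-pres-∣ (divides-difference x≡y) p∣geomSum)))
    where
    p∣geomSum : + suc k ∣ geomSum x y (suc k)
    p∣geomSum = ∣-resp-≡-mod (geomSum-≡-mod (≡-mod-∣ p∣m x≡y) k) (divides (y ^ k) (ℤ.*-comm (+ suc k) (y ^ k)))

  ^-lift-≡-mod-pow : ∀ {p x y} N → x ≡ y mod p → x ^ (p ℕ.^ N) ≡ y ^ (p ℕ.^ N) mod (p ℕ.^ suc N)
  ^-lift-≡-mod-pow {p} {x} {y} zero    x≡y =
    subst₂ (λ s t → s ≡ t mod (p ℕ.* 1)) (sym (ℤ.^-identityʳ x)) (sym (ℤ.^-identityʳ y)) (≡-mod-∣ (ℕ.∣-reflexive (ℕ.*-identityʳ p)) x≡y)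
  ^-lift-≡-mod-pow {p} {x} {y} (suc N) x≡y =
    subst₂ (λ s t → s ≡ t mod (p ℕ.^ suc (suc N))) (pow x) (pow y)
      (^-lift-≡-mod {p} (ℕ.m∣m*n (p ℕ.^ N)) (^-lift-≡-mod-pow N x≡y))
    where
    pow : ∀ z → (z ^ (p ℕ.^ N)) ^ p ≡ z ^ (p ℕ.^ suc N)
    pow z = trans (ℤ.^-*-assoc z (p ℕ.^ N) p) (cong (z ^_) (ℕ.*-comm (p ℕ.^ N) p))

module _ where
  open import Data.Integer using (_+_; _*_; _-_; _^_)
  open import Data.Nat.Combinatorics using (_C_; nCn≡1)

  powerSum : ℕ → ℕ → ℤ
  powerSum n j = ∑ n (λ b → (+ b) ^ j)

  ∑-C-powerSum : ∀ n j → ∑ (suc j) (λ i → + (suc j C i) * powerSum n i) ≡ (+ n) ^ suc j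
  ∑-C-powerSum n j = begin
    ∑ (suc j) (λ i → + (suc j C i) * powerSum n i)           ≡⟨ ∑-cong (suc j) (λ i _ → sym (*-distribˡ-∑ n (+ (suc j C i)) (λ b → (+ b) ^ i))) ⟩
    ∑ (suc j) (λ i → ∑ n (λ b → + (suc j C i) * (+ b) ^ i))  ≡⟨ ∑-comm (suc j) n _ ⟩
    ∑ n (λ b → ∑ (suc j) (λ i → + (suc j C i) * (+ b) ^ i))  ≡⟨ ∑-cong n (λ b _ → sym (difference b)) ⟩
    ∑ n (λ b → (+ suc b) ^ suc j - (+ b) ^ suc j)            ≡⟨ ∑-telescope n (λ b → (+ b) ^ suc j) ⟩
    (+ n) ^ suc j - 0ℤ                                       ≡⟨ ℤ.+-identityʳ _ ⟩
    (+ n) ^ suc j                                            ∎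
    where
    open ≡-Reasoning
    difference : ∀ b → (+ suc b) ^ suc j - (+ b) ^ suc j ≡ ∑ (suc j) (λ i → + (suc j C i) * (+ b) ^ i)
    difference b = begin
      (+ suc b) ^ suc j - (+ b) ^ suc j                      ≡⟨ cong (λ t → t ^ suc j - (+ b) ^ suc j) (ℤ.pos-+ 1 b) ⟩
      (1ℤ + + b) ^ suc j - (+ b) ^ suc j                     ≡⟨ cong (λ t → t ^ suc j - (+ b) ^ suc j) (ℤ.+-comm 1ℤ (+ b)) ⟩
      (+ b + 1ℤ) ^ suc j - (+ b) ^ suc j                     ≡⟨ cong (_- (+ b) ^ suc j) (binomial (+ b) (suc j)) ⟩
      S + + (suc j C suc j) * (+ b) ^ suc j - (+ b) ^ suc j  ≡⟨ cong (λ c → S + + c * (+ b) ^ suc j - (+ b) ^ suc j) (nCn≡1 (suc j)) ⟩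
      S + 1ℤ * (+ b) ^ suc j - (+ b) ^ suc j                 ≡⟨ lemma S ((+ b) ^ suc j) ⟩
      S                                                      ∎
      where
      S = ∑ (suc j) (λ i → + (suc j C i) * (+ b) ^ i)
      lemma : ∀ s x → s + 1ℤ * x - x ≡ s
      lemma = solve-∀

module _ where
  open import Data.Nat using (_+_; _∸_; _%_; NonZero)
  open import Data.Nat.DivMod using ([m+kn]%n≡m%n)
  open import Data.Integer.Divisibility.Signed using (∣⇒∣ᵤ)

  ≡-mod⇒%≡ : ∀ {n} .{{_ : NonZero n}} {a b} → + a ≡ + b mod n → a % n ≡ b % n
  ≡-mod⇒%≡ {n} {a} {b} a≡b =
    [ (λ b≤a → ≤-case b≤a a≡b) , (λ a≤b → sym (≤-case a≤b (≡-mod-sym a≡b))) ]′ (ℕ.≤-total b a)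
    where
    ≤-case : ∀ {a b} → b ≤ a → + a ≡ + b mod n → a % n ≡ b % n
    ≤-case {a} {b} b≤a (mod-by n∣a-b) with ∣⇒∣ᵤ n∣a-b
    ... | ℕ.divides k eq = begin
      a % n              ≡⟨ cong (_% n) (ℕ.m+[n∸m]≡n b≤a) ⟨
      (b + (a ∸ b)) % n  ≡⟨ cong (λ t → (b + t) % n) (trans (sym ∣a-b∣) eq) ⟩
      (b + k ℕ.* n) % n  ≡⟨ [m+kn]%n≡m%n b k n ⟩
      b % n              ∎
      where
      open ≡-Reasoning
      ∣a-b∣ : ℤ.∣ + a ℤ.- + b ∣ ≡ a ∸ b
      ∣a-b∣ = cong ℤ.∣_∣ (trans (ℤ.m-n≡m⊖n a b) (ℤ.⊖-≥ b≤a))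

-- Sums over a residue class

module _ where
  open import Data.Integer using (_+_; _*_; _-_)
  open import Data.Integer.Divisibility.Signed using (_∣_; divides; ∣ᵤ⇒∣; ∣⇒∣ᵤ; ∣m∣n⇒∣m+n; ∣m∣n⇒∣m-n)
  open import Data.Nat.Divisibility using (_∣?_)
  open import Data.List using (foldr; map; applyUpTo)
  open import Data.Bool using (if_then_else_)
  open import Relation.Nullary.Decidable using (⌊_⌋)
  open import Function using (id)
  open ≡-Reasoning

  restrict : ℕ → ℤ → (ℕ → ℤ) → ℕ → ℤ
  restrict q r g k = if ⌊ q ∣? ℤ.∣ + k - r ∣ ⌋ then g k else 0ℤ

  sumRes≡∑ : ∀ q r n g → sumRes q r n g ≡ ∑ (suc n) (restrict q r g)
  sumRes≡∑ q r n g = foldr-map-applyUpTo (suc n) (restrict q r g) id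
    where
    foldr-map-applyUpTo : ∀ m (F : ℕ → ℤ) f → foldr _+_ 0ℤ (map F (applyUpTo f m)) ≡ ∑ m (F ∘ f)
    foldr-map-applyUpTo zero    F f = refl
    foldr-map-applyUpTo (suc m) F f = begin
      F (f 0) + foldr _+_ 0ℤ (map F (applyUpTo (f ∘ suc) m))  ≡⟨ cong (λ t → F (f 0) + t) (foldr-map-applyUpTo m F (f ∘ suc)) ⟩
      F (f 0) + ∑ m (F ∘ f ∘ suc)                             ≡⟨ ∑-head m (F ∘ f) ⟨
      ∑ (suc m) (F ∘ f)                                       ∎

  sumRes-cong : ∀ q r n {g h} → (∀ k → g k ≡ h k) → sumRes q r n g ≡ sumRes q r n h
  sumRes-cong q r n {g} {h} g≡h = begin
    sumRes q r n g              ≡⟨ sumRes≡∑ q r n g ⟩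
    ∑ (suc n) (restrict q r g)  ≡⟨ ∑-cong (suc n) (λ k _ → cong (if ⌊ q ∣? ℤ.∣ + k - r ∣ ⌋ then_else 0ℤ) (g≡h k)) ⟩
    ∑ (suc n) (restrict q r h)  ≡⟨ sumRes≡∑ q r n h ⟨
    sumRes q r n h              ∎

  sumRes-* : ∀ q r n c g → sumRes q r n (λ k → c * g k) ≡ c * sumRes q r n g
  sumRes-* q r n c g = begin
    sumRes q r n (λ k → c * g k)              ≡⟨ sumRes≡∑ q r n _ ⟩
    ∑ (suc n) (restrict q r (λ k → c * g k))  ≡⟨ ∑-cong (suc n) (λ k _ → restrict-* k) ⟩
    ∑ (suc n) (λ k → c * restrict q r g k)    ≡⟨ *-distribˡ-∑ (suc n) c _ ⟩
    c * ∑ (suc n) (restrict q r g)            ≡⟨ cong (c *_) (sumRes≡∑ q r n g) ⟨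
    c * sumRes q r n g                        ∎
    where
    restrict-* : ∀ k → restrict q r (λ k → c * g k) k ≡ c * restrict q r g k
    restrict-* k with ⌊ q ∣? ℤ.∣ + k - r ∣ ⌋
    ... | true  = refl
    ... | false = sym (ℤ.*-zeroʳ c)

  natNeg : ℕ → ℤ → ℕ
  natNeg q₀ (+ m)    = m ℕ.* q₀
  natNeg q₀ -[1+ m ] = suc m

  ∣r+natNeg : ∀ q₀ r → + suc q₀ ∣ r + + natNeg q₀ r
  ∣r+natNeg q₀ (+ m)    = divides (+ m) (begin
    + (m ℕ.+ m ℕ.* q₀)  ≡⟨ cong +_ (ℕ.*-suc m q₀) ⟨
    + (m ℕ.* suc q₀)    ≡⟨ ℤ.pos-* m (suc q₀) ⟩
    + m * + suc q₀      ∎)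
  ∣r+natNeg q₀ -[1+ m ] = divides 0ℤ (ℤ.n⊖n≡0 (suc m))

  ∣k-r∣⇔∣k+natNeg : ∀ q₀ k r → (suc q₀ ℕ.∣ ℤ.∣ + k - r ∣) ⇔ (suc q₀ ℕ.∣ k ℕ.+ natNeg q₀ r)
  ∣k-r∣⇔∣k+natNeg q₀ k r = mk⇔ to from
    where
    ρ = natNeg q₀ r
    to : suc q₀ ℕ.∣ ℤ.∣ + k - r ∣ → suc q₀ ℕ.∣ k ℕ.+ ρ
    to q∣k-r = ∣⇒∣ᵤ (subst (+ suc q₀ ∣_) eq (∣m∣n⇒∣m+n (∣ᵤ⇒∣ {+ suc q₀} {+ k - r} q∣k-r) (∣r+natNeg q₀ r)))
      where
      eq : + k - r + (r + + ρ) ≡ + (k ℕ.+ ρ)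
      eq = trans (lemma (+ k) r (+ ρ)) (sym (ℤ.pos-+ k ρ))
        where
        lemma : ∀ a b c → a - b + (b + c) ≡ a + c
        lemma = solve-∀
    from : suc q₀ ℕ.∣ k ℕ.+ ρ → suc q₀ ℕ.∣ ℤ.∣ + k - r ∣
    from q∣k+ρ = ∣⇒∣ᵤ (subst (+ suc q₀ ∣_) eq (∣m∣n⇒∣m-n (∣ᵤ⇒∣ {+ suc q₀} {+ (k ℕ.+ ρ)} q∣k+ρ) (∣r+natNeg q₀ r)))
      where
      eq : + (k ℕ.+ ρ) - (r + + ρ) ≡ + k - r
      eq = trans (cong (_- (r + + ρ)) (ℤ.pos-+ k ρ)) (lemma (+ k) r (+ ρ))
        where
        lemma : ∀ a b c → a + c - (b + c) ≡ a - b
        lemma = solve-∀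

-- Stirling numbers, rising factorials and finite differences

module _ where
  open import Data.Integer using (_+_; _*_; -_; _-_; _^_)
  open import Data.Integer.Divisibility.Signed using (_∣_; divides; ∣-refl; ∣m∣n⇒∣m+n; ∣m∣n⇒∣m-n; ∣m+n∣n⇒∣m)
  open import Data.Nat using (_!)
  open ≡-Reasoning

  stirling₁-0 : ∀ {n k} → n < k → stir1 n k ≡ 0
  stirling₁-0 {zero}  {suc k} _         = refl
  stirling₁-0 {suc n} {suc k} (s≤s n<k) =
    trans (cong₂ (λ a b → n ℕ.* a ℕ.+ b) (stirling₁-0 (ℕ.m<n⇒m<1+n n<k)) (stirling₁-0 n<k)) (cong (ℕ._+ 0) (ℕ.*-zeroʳ n))

  n*stirling₁[n,0]≡0 : ∀ n x → + n * (+ stir1 n 0 * x) ≡ 0ℤ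
  n*stirling₁[n,0]≡0 zero    x = ℤ.*-zeroˡ (1ℤ * x)
  n*stirling₁[n,0]≡0 (suc n) x = trans (cong (+ suc n *_) (ℤ.*-zeroˡ x)) (ℤ.*-zeroʳ (+ suc n))

  ∑-stirling₁-suc : ∀ n (g : ℕ → ℤ) →
    ∑ (2 ℕ.+ n) (λ k → + stir1 (suc n) k * g k) ≡
    + n * ∑ (suc n) (λ k → + stir1 n k * g k) + ∑ (suc n) (λ k → + stir1 n k * g (suc k))
  ∑-stirling₁-suc n g = begin
    ∑ (2 ℕ.+ n) (λ k → + stir1 (suc n) k * g k)                       ≡⟨ ∑-head (suc n) _ ⟩
    0ℤ * g 0 + ∑ (suc n) (λ k → + stir1 (suc n) (suc k) * g (suc k))  ≡⟨ ℤ.+-identityˡ _ ⟩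
    ∑ (suc n) (λ k → + stir1 (suc n) (suc k) * g (suc k))             ≡⟨ ∑-cong (suc n) (λ k _ → recurrence k) ⟩
    ∑ (suc n) (λ k → + n * F (suc k) + + stir1 n k * g (suc k))       ≡⟨ ∑-distrib-+ (suc n) _ _ ⟩
    ∑ (suc n) (λ k → + n * F (suc k)) + B                             ≡⟨ cong (_+ B) (*-distribˡ-∑ (suc n) (+ n) (F ∘ suc)) ⟩
    + n * ∑ (suc n) (F ∘ suc) + B                                     ≡⟨ cong (_+ B) shift ⟩
    + n * ∑ (suc n) F + B                                             ∎
    where
    F : ℕ → ℤ
    F k = + stir1 n k * g k
    B = ∑ (suc n) (λ k → + stir1 n k * g (suc k))
    recurrence : ∀ k → + stir1 (suc n) (suc k) * g (suc k) ≡ + n * F (suc k) + + stir1 n k * g (suc k)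
    recurrence k = begin
      + (n ℕ.* stir1 n (suc k) ℕ.+ stir1 n k) * g (suc k)    ≡⟨ cong (_* g (suc k)) (ℤ.pos-+ (n ℕ.* stir1 n (suc k)) (stir1 n k)) ⟩
      (+ (n ℕ.* stir1 n (suc k)) + + stir1 n k) * g (suc k)  ≡⟨ cong (λ t → (t + + stir1 n k) * g (suc k)) (ℤ.pos-* n (stir1 n (suc k))) ⟩
      (+ n * + stir1 n (suc k) + + stir1 n k) * g (suc k)    ≡⟨ lemma (+ n) (+ stir1 n (suc k)) (+ stir1 n k) (g (suc k)) ⟩
      + n * F (suc k) + + stir1 n k * g (suc k)              ∎
      where
      lemma : ∀ a b c x → (a * b + c) * x ≡ a * (b * x) + c * x
      lemma = solve-∀
    shift : + n * ∑ (suc n) (F ∘ suc) ≡ + n * ∑ (suc n) F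
    shift = begin
      + n * (∑ n (F ∘ suc) + F (suc n))       ≡⟨ cong (λ t → + n * (∑ n (F ∘ suc) + t * g (suc n))) (cong +_ (stirling₁-0 {n} ℕ.≤-refl)) ⟩
      + n * (∑ n (F ∘ suc) + 0ℤ * g (suc n))  ≡⟨ cong (λ t → + n * (∑ n (F ∘ suc) + t)) (ℤ.*-zeroˡ (g (suc n))) ⟩
      + n * (∑ n (F ∘ suc) + 0ℤ)              ≡⟨ cong (+ n *_) (ℤ.+-identityʳ _) ⟩
      + n * ∑ n (F ∘ suc)                     ≡⟨ ℤ.+-identityˡ _ ⟨
      0ℤ + + n * ∑ n (F ∘ suc)                ≡⟨ cong (_+ + n * ∑ n (F ∘ suc)) n*F0≡0 ⟨
      + n * F 0 + + n * ∑ n (F ∘ suc)         ≡⟨ ℤ.*-distribˡ-+ (+ n) (F 0) _ ⟨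
      + n * (F 0 + ∑ n (F ∘ suc))             ≡⟨ cong (+ n *_) (∑-head n F) ⟨
      + n * ∑ (suc n) F                       ∎
      where
      n*F0≡0 : + n * F 0 ≡ 0ℤ
      n*F0≡0 = n*stirling₁[n,0]≡0 n (g 0)

  ℤ-induction : ∀ (P : ℤ → Set) → P 0ℤ → (∀ z → P z → P (z + 1ℤ)) → (∀ z → P (z + 1ℤ) → P z) → ∀ z → P z
  ℤ-induction P P0 up down (+ zero)     = P0
  ℤ-induction P P0 up down (+ suc k)    = subst P (cong +_ (ℕ.+-comm k 1)) (up (+ k) (ℤ-induction P P0 up down (+ k)))
  ℤ-induction P P0 up down -[1+ zero ]  = down -[1+ zero ] P0
  ℤ-induction P P0 up down -[1+ suc k ] = down -[1+ suc k ] (ℤ-induction P P0 up down -[1+ k ])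

  rising : ℕ → ℤ → ℤ
  rising zero    z = 1ℤ
  rising (suc n) z = rising n z * (z + + n)

  ∑-stirling₁≡rising : ∀ n z → ∑ (suc n) (λ k → + stir1 n k * z ^ k) ≡ rising n z
  ∑-stirling₁≡rising zero    z = refl
  ∑-stirling₁≡rising (suc n) z = begin
    ∑ (2 ℕ.+ n) (λ k → + stir1 (suc n) k * z ^ k)  ≡⟨ ∑-stirling₁-suc n (z ^_) ⟩
    + n * ∑ (suc n) (λ k → + stir1 n k * z ^ k) + ∑ (suc n) (λ k → + stir1 n k * z ^ suc k)
                                                                          ≡⟨ cong (λ t → + n * S + t) (∑-cong (suc n) (λ k _ → lemma₁ (+ stir1 n k) z (z ^ k))) ⟩
    + n * S + ∑ (suc n) (λ k → z * (+ stir1 n k * z ^ k))  ≡⟨ cong (λ t → + n * S + t) (*-distribˡ-∑ (suc n) z _) ⟩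
    + n * S + z * S                                        ≡⟨ cong (λ t → + n * t + z * t) (∑-stirling₁≡rising n z) ⟩
    + n * rising n z + z * rising n z                      ≡⟨ lemma₂ (+ n) z (rising n z) ⟩
    rising n z * (z + + n)                                 ∎
    where
    S = ∑ (suc n) (λ k → + stir1 n k * z ^ k)
    lemma₁ : ∀ s z y → s * (z * y) ≡ z * (s * y)
    lemma₁ = solve-∀
    lemma₂ : ∀ n z r → n * r + z * r ≡ r * (z + n)
    lemma₂ = solve-∀

  rising-suc : ∀ n z → rising (suc n) z ≡ z * rising n (z + 1ℤ)
  rising-suc zero    z = lemma z
    where
    lemma : ∀ z → 1ℤ * (z + 0ℤ) ≡ z * 1ℤ
    lemma = solve-∀
  rising-suc (suc n) z = begin
    rising (suc n) z * (z + + suc n)       ≡⟨ cong (_* (z + + suc n)) (rising-suc n z) ⟩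
    z * rising n (z + 1ℤ) * (z + + suc n)  ≡⟨ lemma z (rising n (z + 1ℤ)) (+ n) ⟩
    z * (rising n (z + 1ℤ) * (z + 1ℤ + + n))  ∎
    where
    lemma : ∀ z r n → z * r * (z + (1ℤ + n)) ≡ z * (r * (z + 1ℤ + n))
    lemma = solve-∀

  rising-difference : ∀ n z → rising (suc n) (z + 1ℤ) ≡ rising (suc n) z + + suc n * rising n (z + 1ℤ)
  rising-difference n z = begin
    rising n (z + 1ℤ) * (z + 1ℤ + + n)                   ≡⟨ lemma z (rising n (z + 1ℤ)) (+ n) ⟩
    z * rising n (z + 1ℤ) + + suc n * rising n (z + 1ℤ)  ≡⟨ cong (_+ + suc n * rising n (z + 1ℤ)) (rising-suc n z) ⟨
    rising (suc n) z + + suc n * rising n (z + 1ℤ)       ∎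
    where
    lemma : ∀ z r n → r * (z + 1ℤ + n) ≡ z * r + (1ℤ + n) * r
    lemma = solve-∀

  n!∣rising : ∀ n z → + (n !) ∣ rising n z
  n!∣rising zero    z = divides 1ℤ refl
  n!∣rising (suc n) = ℤ-induction (λ z → + (suc n !) ∣ rising (suc n) z) at-0 up down
    where
    [1+n]!∣next : ∀ z → + (suc n !) ∣ + suc n * rising n (z + 1ℤ)
    [1+n]!∣next z = subst (_∣ + suc n * rising n (z + 1ℤ)) (sym (ℤ.pos-* (suc n) (n !))) (*-pres-∣ (∣-refl {+ suc n}) (n!∣rising n (z + 1ℤ)))
    at-0 : + (suc n !) ∣ rising (suc n) 0ℤ
    at-0 = subst (+ (suc n !) ∣_) (trans (sym (ℤ.*-zeroˡ (rising n 1ℤ))) (sym (rising-suc n 0ℤ))) (divides 0ℤ refl)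
    up : ∀ z → + (suc n !) ∣ rising (suc n) z → + (suc n !) ∣ rising (suc n) (z + 1ℤ)
    up z ∣r = subst (+ (suc n !) ∣_) (sym (rising-difference n z)) (∣m∣n⇒∣m+n ∣r ([1+n]!∣next z))
    down : ∀ z → + (suc n !) ∣ rising (suc n) (z + 1ℤ) → + (suc n !) ∣ rising (suc n) z
    down z ∣r = ∣m+n∣n⇒∣m (subst (+ (suc n !) ∣_) (rising-difference n z) ∣r) ([1+n]!∣next z)

  Δ : (ℤ → ℤ) → ℤ → ℤ
  Δ F x = F (x + 1ℤ) - F x

  Δ^ : ℕ → (ℤ → ℤ) → ℤ → ℤ
  Δ^ zero    F = F
  Δ^ (suc m) F = Δ^ m (Δ F)

  Δ^-cong : ∀ m {F G} → (∀ x → F x ≡ G x) → ∀ x → Δ^ m F x ≡ Δ^ m G x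
  Δ^-cong zero    F≡G = F≡G
  Δ^-cong (suc m) F≡G = Δ^-cong m (λ y → cong₂ _-_ (F≡G (y + 1ℤ)) (F≡G y))

  Δ^-+ : ∀ m F G x → Δ^ m (λ y → F y + G y) x ≡ Δ^ m F x + Δ^ m G x
  Δ^-+ zero    F G x = refl
  Δ^-+ (suc m) F G x = trans (Δ^-cong m (λ y → lemma (F (y + 1ℤ)) (G (y + 1ℤ)) (F y) (G y)) x) (Δ^-+ m (Δ F) (Δ G) x)
    where
    lemma : ∀ a b c d → a + b - (c + d) ≡ (a - c) + (b - d)
    lemma = solve-∀

  Δ^-*ˡ : ∀ m c F x → Δ^ m (λ y → c * F y) x ≡ c * Δ^ m F x
  Δ^-*ˡ zero    c F x = refl
  Δ^-*ˡ (suc m) c F x = trans (Δ^-cong m (λ y → lemma c (F (y + 1ℤ)) (F y)) x) (Δ^-*ˡ m c (Δ F) x)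
    where
    lemma : ∀ c a b → c * a - c * b ≡ c * (a - b)
    lemma = solve-∀

  Δ^-0 : ∀ m x → Δ^ m (λ _ → 0ℤ) x ≡ 0ℤ
  Δ^-0 m x = begin
    Δ^ m (λ _ → 0ℤ) x       ≡⟨ Δ^-*ˡ m 0ℤ (λ _ → 0ℤ) x ⟩
    0ℤ * Δ^ m (λ _ → 0ℤ) x  ≡⟨ ℤ.*-zeroˡ (Δ^ m (λ _ → 0ℤ) x) ⟩
    0ℤ                      ∎

  Δ^-∑ : ∀ m n (F : ℕ → ℤ → ℤ) x → Δ^ m (λ y → ∑ n (λ k → F k y)) x ≡ ∑ n (λ k → Δ^ m (F k) x)
  Δ^-∑ m zero    F x = Δ^-0 m x
  Δ^-∑ m (suc n) F x = trans (Δ^-+ m (λ y → ∑ n (λ k → F k y)) (F n) x) (cong (_+ Δ^ m (F n) x) (Δ^-∑ m n F x))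

  ∣-Δ^ : ∀ {d} m F → (∀ x → d ∣ F x) → ∀ x → d ∣ Δ^ m F x
  ∣-Δ^ zero    F d∣F = d∣F
  ∣-Δ^ (suc m) F d∣F = ∣-Δ^ m (Δ F) (λ y → ∣m∣n⇒∣m-n (d∣F (y + 1ℤ)) (d∣F y))

  Δ^-suc : ∀ m F x → Δ^ (suc m) F x ≡ Δ^ m F (x + 1ℤ) - Δ^ m F x
  Δ^-suc zero    F x = refl
  Δ^-suc (suc m) F x = Δ^-suc m (Δ F) x

  Δ^-shift : ∀ m F x → Δ^ m (λ t → F (t + 1ℤ)) x ≡ Δ^ m F (x + 1ℤ)
  Δ^-shift zero    F x = refl
  Δ^-shift (suc m) F x = Δ^-shift m (Δ F) x

  Δ^-leibniz : ∀ m g x → Δ^ (suc m) (λ t → t * g t) x ≡ x * Δ^ (suc m) g x + + suc m * Δ^ m g (x + 1ℤ)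
  Δ^-leibniz zero    g x = lemma x (g (x + 1ℤ)) (g x)
    where
    lemma : ∀ x a b → (x + 1ℤ) * a - x * b ≡ x * (a - b) + 1ℤ * a
    lemma = solve-∀
  Δ^-leibniz (suc m) g x = begin
    Δ^ (suc m) (Δ (λ t → t * g t)) x                                  ≡⟨ Δ^-cong (suc m) (λ t → lemma₁ t (g (t + 1ℤ)) (g t)) x ⟩
    Δ^ (suc m) (λ t → t * Δ g t + g (t + 1ℤ)) x                       ≡⟨ Δ^-+ (suc m) (λ t → t * Δ g t) (λ t → g (t + 1ℤ)) x ⟩
    Δ^ (suc m) (λ t → t * Δ g t) x + Δ^ (suc m) (λ t → g (t + 1ℤ)) x  ≡⟨ cong₂ _+_ (Δ^-leibniz m (Δ g) x) (Δ^-shift (suc m) g x) ⟩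
    x * A + + suc m * B + B                                           ≡⟨ lemma₂ x A B (+ m) ⟩
    x * A + + suc (suc m) * B                                         ∎
    where
    A = Δ^ (suc m) (Δ g) x
    B = Δ^ m (Δ g) (x + 1ℤ)
    lemma₁ : ∀ t a b → (t + 1ℤ) * a - t * b ≡ t * (a - b) + a
    lemma₁ = solve-∀
    lemma₂ : ∀ x a b m → x * a + (1ℤ + m) * b + b ≡ x * a + (1ℤ + (1ℤ + m)) * b
    lemma₂ = solve-∀

  Δ^-pow-at-0 : ∀ k m → Δ^ m (_^ k) 0ℤ ≡ + (m !) * + stir2 k m
  Δ^-pow-at-0 zero    zero    = refl
  Δ^-pow-at-0 zero    (suc m) = begin
    Δ^ m (Δ (_^ 0)) 0ℤ  ≡⟨ Δ^-cong m (λ _ → ℤ.+-inverseʳ 1ℤ) 0ℤ ⟩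
    Δ^ m (λ _ → 0ℤ) 0ℤ  ≡⟨ Δ^-0 m 0ℤ ⟩
    0ℤ                  ≡⟨ ℤ.*-zeroʳ (+ (suc m !)) ⟨
    + (suc m !) * 0ℤ    ∎
  Δ^-pow-at-0 (suc k) zero    = refl
  Δ^-pow-at-0 (suc k) (suc m) = begin
    Δ^ (suc m) (λ x → x * x ^ k) 0ℤ                       ≡⟨ Δ^-leibniz m (_^ k) 0ℤ ⟩
    0ℤ * Δ^ (suc m) (_^ k) 0ℤ + + suc m * Δ^ m (_^ k) 1ℤ  ≡⟨ cong₂ (λ a b → a + + suc m * b) (ℤ.*-zeroˡ (Δ^ (suc m) (_^ k) 0ℤ)) at-1 ⟩
    0ℤ + + suc m * (E m + E (suc m))                      ≡⟨ cong₂ (λ a b → 0ℤ + + suc m * (a + b)) (Δ^-pow-at-0 k m) (Δ^-pow-at-0 k (suc m)) ⟩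
    0ℤ + + suc m * (+ (m !) * A + + (suc m !) * B)        ≡⟨ cong (λ t → 0ℤ + + suc m * (+ (m !) * A + t * B)) (ℤ.pos-* (suc m) (m !)) ⟩
    0ℤ + + suc m * (+ (m !) * A + + suc m * + (m !) * B)  ≡⟨ lemma (+ suc m) (+ (m !)) A B ⟩
    + suc m * + (m !) * (+ suc m * B + A)                 ≡⟨ cong₂ _*_ (ℤ.pos-* (suc m) (m !)) (trans (ℤ.pos-+ (suc m ℕ.* stir2 k (suc m)) (stir2 k m)) (cong (_+ A) (ℤ.pos-* (suc m) (stir2 k (suc m))))) ⟨
    + (suc m !) * + stir2 (suc k) (suc m)                 ∎
    where
    E : ℕ → ℤ
    E j = Δ^ j (_^ k) 0ℤ
    A = + stir2 k m
    B = + stir2 k (suc m)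
    at-1 : Δ^ m (_^ k) 1ℤ ≡ E m + E (suc m)
    at-1 = begin
      Δ^ m (_^ k) 1ℤ                ≡⟨ lemma′ (E m) (Δ^ m (_^ k) 1ℤ) ⟩
      E m + (Δ^ m (_^ k) 1ℤ - E m)  ≡⟨ cong (λ t → E m + t) (Δ^-suc m (_^ k) 0ℤ) ⟨
      E m + E (suc m)               ∎
      where
      lemma′ : ∀ b a → a ≡ b + (a - b)
      lemma′ = solve-∀
    lemma : ∀ s f a b → 0ℤ + s * (f * a + s * f * b) ≡ s * f * (s * b + a)
    lemma = solve-∀

  Δ^-rising : ∀ n m y → Δ^ m (λ x → rising n (x * y)) 0ℤ ≡ + (m !) * ∑ (suc n) (λ k → + (stir1 n k ℕ.* stir2 k m) * y ^ k)
  Δ^-rising n m y = begin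
    Δ^ m (λ x → rising n (x * y)) 0ℤ                                   ≡⟨ Δ^-cong m (λ x → trans (sym (∑-stirling₁≡rising n (x * y))) (∑-cong (suc n) (λ k _ → split x k))) 0ℤ ⟩
    Δ^ m (λ x → ∑ (suc n) (λ k → c k * x ^ k)) 0ℤ                      ≡⟨ Δ^-∑ m (suc n) (λ k x → c k * x ^ k) 0ℤ ⟩
    ∑ (suc n) (λ k → Δ^ m (λ x → c k * x ^ k) 0ℤ)                      ≡⟨ ∑-cong (suc n) (λ k _ → Δ^-*ˡ m (c k) (_^ k) 0ℤ) ⟩
    ∑ (suc n) (λ k → c k * Δ^ m (_^ k) 0ℤ)                             ≡⟨ ∑-cong (suc n) (λ k _ → trans (cong (c k *_) (Δ^-pow-at-0 k m)) (collect k)) ⟩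
    ∑ (suc n) (λ k → + (m !) * (+ (stir1 n k ℕ.* stir2 k m) * y ^ k))  ≡⟨ *-distribˡ-∑ (suc n) (+ (m !)) _ ⟩
    + (m !) * ∑ (suc n) (λ k → + (stir1 n k ℕ.* stir2 k m) * y ^ k)    ∎
    where
    c : ℕ → ℤ
    c k = + stir1 n k * y ^ k
    split : ∀ x k → + stir1 n k * (x * y) ^ k ≡ c k * x ^ k
    split x k = trans (cong (+ stir1 n k *_) (^-distribʳ-* x y k)) (lemma (+ stir1 n k) (x ^ k) (y ^ k))
      where
      lemma : ∀ s a b → s * (a * b) ≡ s * b * a
      lemma = solve-∀
    collect : ∀ k → c k * (+ (m !) * + stir2 k m) ≡ + (m !) * (+ (stir1 n k ℕ.* stir2 k m) * y ^ k)
    collect k = trans (lemma (+ stir1 n k) (y ^ k) (+ (m !)) (+ stir2 k m))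
                      (cong (λ t → + (m !) * (t * y ^ k)) (sym (ℤ.pos-* (stir1 n k) (stir2 k m))))
      where
      lemma : ∀ s b f t → s * b * (f * t) ≡ f * (s * t * b)
      lemma = solve-∀

  n!∣m!∑stirling : ∀ n m y → + (n !) ∣ + (m !) * ∑ (suc n) (λ k → + (stir1 n k ℕ.* stir2 k m) * y ^ k)
  n!∣m!∑stirling n m y = subst (+ (n !) ∣_) (Δ^-rising n m y) (∣-Δ^ m _ (λ x → n!∣rising n (x * y)) 0ℤ)

module _ where
  open import Data.Nat using (_+_; _∸_)
  open import Data.Nat.Properties

  indicator : ∀ {A : Set} → Dec A → ℕ
  indicator (yes _) = 1
  indicator (no  _) = 0

  indicator≤1 : ∀ {A : Set} (a? : Dec A) → indicator a? ≤ 1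
  indicator≤1 (yes _) = ≤-refl
  indicator≤1 (no  _) = z≤n

  module _ {P : ℕ → Set} (P? : ∀ j → Dec (P j)) where

    count : ℕ → ℕ
    count m = ∑ℕ m (λ j → indicator (P? j))

    count-≤ : ∀ m → count m ≤ m
    count-≤ zero    = z≤n
    count-≤ (suc m) = ≤-trans (+-mono-≤ (count-≤ m) (indicator≤1 (P? m))) (≤-reflexive (+-comm m 1))

    count-+ : ∀ a b → count (a + b) ≡ count a + ∑ℕ b (λ j → indicator (P? (a + j)))
    count-+ a b = ∑ℕ-split a b _

    count-mono-≤ : ∀ {m m′} → m ≤ m′ → count m ≤ count m′
    count-mono-≤ {m} {m′} m≤m′ = begin
      count m               ≤⟨ m≤m+n (count m) _ ⟩
      count m + _           ≡⟨ count-+ m (m′ ∸ m) ⟨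
      count (m + (m′ ∸ m))  ≡⟨ cong count (m+[n∸m]≡n m≤m′) ⟩
      count m′              ∎
      where open ≤-Reasoning

    count-≥ : ∀ {k m} → k ≤ m → (∀ j → j < k → P j) → k ≤ count m
    count-≥ {zero}  {m}     _         _    = z≤n
    count-≥ {suc k} {suc m} (s≤s k≤m) Pj<k with P? m
    ... | yes _ = ≤-trans (≤-reflexive (+-comm 1 k)) (+-monoˡ-≤ 1 (count-≥ k≤m (λ j j<k → Pj<k j (m<n⇒m<1+n j<k))))
    ... | no ¬Pm with m≤n⇒m<n∨m≡n k≤m
    ...   | inj₁ k<m  = ≤-trans (count-≥ k<m Pj<k) (m≤m+n _ 0)
    ...   | inj₂ refl = contradiction (Pj<k k ≤-refl) ¬Pm

    count-pos : ∀ {j m} → P j → j < m → 1 ≤ count m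
    count-pos {j} {suc m} Pj j<1+m with P? m
    ... | yes _ = ≤-trans (s≤s z≤n) (≤-reflexive (+-comm 1 (count m)))
    ... | no ¬Pm with m<1+n⇒m<n∨m≡n j<1+m
    ...   | inj₁ j<m  = ≤-trans (count-pos Pj j<m) (m≤m+n _ 0)
    ...   | inj₂ refl = contradiction Pj ¬Pm

    module _ (downward : ∀ t → P (suc t) → P t) where

      downward-≤ : ∀ {s t} → s ≤ t → P t → P s
      downward-≤ {s} {t} s≤t Pt with m≤n⇒m<n∨m≡n s≤t
      ... | inj₂ refl = Pt
      downward-≤ {s} {suc t} s≤t Pt | inj₁ s<1+t = downward-≤ (≤-pred s<1+t) (downward t Pt)

      -- For downward closed P, count T = min(T, least t with ¬ P t).
      count-downward : ∀ T → (∀ t → t < count T → P t) × (∀ t → t < T → P t → t < count T)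
      count-downward zero    = (λ _ ()) , (λ _ ())
      count-downward (suc T) with P? T
      ... | yes PT = (λ t t< → downward-≤ (≤-pred (subst (t <_) count≡ t<)) PT) , (λ t t<1+T _ → subst (t <_) (sym count≡) t<1+T)
        where
        count≡ : count T + 1 ≡ suc T
        count≡ = trans (cong (_+ 1) (≤-antisym (count-≤ T) (count-≥ ≤-refl (λ j j<T → downward-≤ (<⇒≤ j<T) PT)))) (+-comm T 1)
      ... | no ¬PT = (λ t t< → proj₁ (count-downward T) t (subst (t <_) (+-identityʳ _) t<))
                   , (λ t t<1+T Pt → subst (t <_) (sym (+-identityʳ _)) (below t t<1+T Pt))
        where
        below : ∀ t → t < suc T → P t → t < count T
        below t t<1+T Pt with m<1+n⇒m<n∨m≡n t<1+T
        ... | inj₁ t<T  = proj₂ (count-downward T) t t<T Pt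
        ... | inj₂ refl = contradiction Pt ¬PT

  count-⇒ : ∀ {P Q : ℕ → Set} (P? : ∀ j → Dec (P j)) (Q? : ∀ j → Dec (Q j)) m →
            (∀ j → j < m → P j → Q j) → count P? m ≤ count Q? m
  count-⇒ {P} {Q} P? Q? m P⇒Q = ∑ℕ-mono m (λ j j<m → pointwise j (P⇒Q j j<m))
    where
    pointwise : ∀ j → (P j → Q j) → indicator (P? j) ≤ indicator (Q? j)
    pointwise j P⇒Q with P? j | Q? j
    ... | yes _  | yes _  = ≤-refl
    ... | yes Pj | no ¬Qj = contradiction (P⇒Q Pj) ¬Qj
    ... | no _   | _      = z≤n

module _ where
  open import Data.Nat using (_+_; _*_; _/_; NonZero)
  open import Data.Nat.Properties
  open import Data.Nat.DivMod using (/-monoˡ-≤; m*n/n≡m)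
  open import Data.Nat.Divisibility using (_∣?_; divides)

  count-multiples*Q≤n : ∀ Q n → count (λ j → Q ∣? suc j) n * Q ≤ n
  count-multiples*Q≤n Q zero    = z≤n
  count-multiples*Q≤n Q (suc n) with Q ∣? suc n | count-multiples*Q≤n Q n
  ... | no  _                       | c*Q≤n = ≤-trans (≤-reflexive (cong (_* Q) (+-identityʳ (count (λ j → Q ∣? suc j) n)))) (m≤n⇒m≤1+n c*Q≤n)
  ... | yes (divides k 1+n≡k*Q)     | c*Q≤n = begin
    (c + 1) * Q  ≡⟨ cong (_* Q) (+-comm c 1) ⟩
    suc c * Q    ≤⟨ *-monoˡ-≤ Q c<k ⟩
    k * Q        ≡⟨ 1+n≡k*Q ⟨
    suc n        ∎
    where
    open ≤-Reasoning
    c = count (λ j → Q ∣? suc j) n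
    c<k : c < k
    c<k = *-cancelʳ-< Q c k (≤-<-trans c*Q≤n (subst (n <_) 1+n≡k*Q ≤-refl))

  count-multiples≤n/Q : ∀ Q .{{_ : NonZero Q}} n → count (λ j → Q ∣? suc j) n ≤ n / Q
  count-multiples≤n/Q Q n = subst (_≤ n / Q) (m*n/n≡m _ Q) (/-monoˡ-≤ Q (count-multiples*Q≤n Q n))

module _ where
  open import Data.Integer using (_+_; _*_; -_; _-_)
  open import Data.Integer.DivMod using (_%ℕ_; _/ℕ_; n%ℕd<d; a≡a%ℕn+[a/ℕn]*n)
  open import Data.Integer.Divisibility.Signed using (divides; ∣⇒∣ᵤ)
  open import Data.Nat.Divisibility using (_∣?_)
  open import Data.Integer.Tactic.RingSolver using (solve-∀)

  multiplesIn : ℤ → ℕ → ℕ → ℕ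
  multiplesIn y Q n = count (λ j → Q ∣? ℤ.∣ y + + j ∣) n

  multiplesIn-pos : ∀ y {Q} → 0 < Q → 1 ≤ multiplesIn y Q Q
  multiplesIn-pos y {suc Q′} _ = count-pos (λ j → Q ∣? ℤ.∣ y + + j ∣) Q∣y+r (n%ℕd<d (- y) Q)
    where
    Q = suc Q′
    r = (- y) %ℕ Q
    k = (- y) /ℕ Q
    y+r≡-k*Q : y + + r ≡ - k * + Q
    y+r≡-k*Q = begin
      y + + r                        ≡⟨ lemma₁ y (+ r) (k * + Q) ⟩
      y + (+ r + k * + Q) - k * + Q  ≡⟨ cong (λ t → y + t - k * + Q) (a≡a%ℕn+[a/ℕn]*n (- y) Q) ⟨
      y + - y - k * + Q              ≡⟨ lemma₂ y (k * + Q) ⟩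
      - (k * + Q)                    ≡⟨ ℤ.neg-distribˡ-* k (+ Q) ⟩
      - k * + Q                      ∎
      where
      open ≡-Reasoning
      lemma₁ : ∀ y r s → y + r ≡ y + (r + s) - s
      lemma₁ = solve-∀
      lemma₂ : ∀ y s → y + - y - s ≡ - s
      lemma₂ = solve-∀
    Q∣y+r : Q ℕ.∣ ℤ.∣ y + + r ∣
    Q∣y+r = ∣⇒∣ᵤ (divides (- k) y+r≡-k*Q)

  c*Q≤n⇒c≤multiplesIn : ∀ {Q} → 0 < Q → ∀ c y n → c ℕ.* Q ≤ n → c ≤ multiplesIn y Q n
  c*Q≤n⇒c≤multiplesIn {Q} 0<Q zero    y n _       = z≤n
  c*Q≤n⇒c≤multiplesIn {Q} 0<Q (suc c) y n [1+c]Q≤n = subst (λ m → suc c ≤ multiplesIn y Q m) (ℕ.m+[n∸m]≡n Q≤n) (begin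
    suc c                                                              ≤⟨ ℕ.+-mono-≤ (multiplesIn-pos y 0<Q) rest ⟩
    multiplesIn y Q Q ℕ.+ count (λ j → Q ∣? ℤ.∣ y + + (Q ℕ.+ j) ∣) n′  ≡⟨ count-+ (λ j → Q ∣? ℤ.∣ y + + j ∣) Q n′ ⟨
    multiplesIn y Q (Q ℕ.+ n′)                              ∎)
    where
    open ℕ.≤-Reasoning
    Q≤n : Q ≤ n
    Q≤n = ℕ.≤-trans (ℕ.m≤m+n Q (c ℕ.* Q)) [1+c]Q≤n
    n′ = n ℕ.∸ Q
    cQ≤n′ : c ℕ.* Q ≤ n′
    cQ≤n′ = ℕ.+-cancelˡ-≤ Q _ _ (subst (Q ℕ.+ c ℕ.* Q ≤_) (sym (ℕ.m+[n∸m]≡n Q≤n)) [1+c]Q≤n)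
    shift : ∀ j → j < n′ → Q ℕ.∣ ℤ.∣ y + + Q + + j ∣ → Q ℕ.∣ ℤ.∣ y + + (Q ℕ.+ j) ∣
    shift j _ = subst (λ z → Q ℕ.∣ ℤ.∣ z ∣) (trans (ℤ.+-assoc y (+ Q) (+ j)) (cong (λ t → y + t) (sym (ℤ.pos-+ Q j))))
    rest : c ≤ count (λ j → Q ∣? ℤ.∣ y + + (Q ℕ.+ j) ∣) n′
    rest = ℕ.≤-trans (c*Q≤n⇒c≤multiplesIn 0<Q c (y + + Q) n′ cQ≤n′)
                     (count-⇒ (λ j → Q ∣? ℤ.∣ y + + Q + + j ∣) (λ j → Q ∣? ℤ.∣ y + + (Q ℕ.+ j) ∣) n′ shift)

-- Expansion in falling factorials

module _ where
  open import Data.Integer using (_+_; _*_; _^_)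
  open ≡-Reasoning

  stirlingFalling : ℕ → ℕ → ℤ → ℤ
  stirlingFalling n i y = ∑ (suc n) (λ k → + stir1 n k * (+ (k ↓ i) * y ^ k))

  stirlingFalling-suc-0 : ∀ n y → stirlingFalling (suc n) 0 y ≡ (y + + n) * stirlingFalling n 0 y
  stirlingFalling-suc-0 n y = begin
    stirlingFalling (suc n) 0 y                                   ≡⟨ ∑-stirling₁-suc n (λ k → 1ℤ * y ^ k) ⟩
    + n * T + ∑ (suc n) (λ k → + stir1 n k * (1ℤ * (y * y ^ k)))  ≡⟨ cong (λ t → + n * T + t) (∑-cong (suc n) (λ k _ → lemma₁ (+ stir1 n k) y (y ^ k))) ⟩
    + n * T + ∑ (suc n) (λ k → y * (+ stir1 n k * (1ℤ * y ^ k)))  ≡⟨ cong (λ t → + n * T + t) (*-distribˡ-∑ (suc n) y _) ⟩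
    + n * T + y * T                                               ≡⟨ lemma₂ (+ n) y T ⟩
    (y + + n) * T                                                 ∎
    where
    T = stirlingFalling n 0 y
    lemma₁ : ∀ s y a → s * (1ℤ * (y * a)) ≡ y * (s * (1ℤ * a))
    lemma₁ = solve-∀
    lemma₂ : ∀ n y t → n * t + y * t ≡ (y + n) * t
    lemma₂ = solve-∀

  stirlingFalling-suc : ∀ n i y → stirlingFalling (suc n) (suc i) y ≡
                                  (y + + n) * stirlingFalling n (suc i) y + (+ suc i * y) * stirlingFalling n i y
  stirlingFalling-suc n i y = begin
    stirlingFalling (suc n) (suc i) y
      ≡⟨ ∑-stirling₁-suc n (λ k → + (k ↓ suc i) * y ^ k) ⟩
    + n * T₁ + ∑ (suc n) (λ k → + stir1 n k * (+ (suc k ↓ suc i) * (y * y ^ k)))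
      ≡⟨ cong (λ t → + n * T₁ + t) (∑-cong (suc n) (λ k _ → split k)) ⟩
    + n * T₁ + ∑ (suc n) (λ k → y * f₁ k + (+ suc i * y) * f₀ k)
      ≡⟨ cong (λ t → + n * T₁ + t) (∑-distrib-+ (suc n) _ _) ⟩
    + n * T₁ + (∑ (suc n) (λ k → y * f₁ k) + ∑ (suc n) (λ k → (+ suc i * y) * f₀ k))
      ≡⟨ cong₂ (λ a b → + n * T₁ + (a + b)) (*-distribˡ-∑ (suc n) y f₁) (*-distribˡ-∑ (suc n) (+ suc i * y) f₀) ⟩
    + n * T₁ + (y * T₁ + (+ suc i * y) * T₀)
      ≡⟨ lemma (+ n) y T₁ ((+ suc i * y) * T₀) ⟩
    (y + + n) * T₁ + (+ suc i * y) * T₀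
      ∎
    where
    f₁ f₀ : ℕ → ℤ
    f₁ k = + stir1 n k * (+ (k ↓ suc i) * y ^ k)
    f₀ k = + stir1 n k * (+ (k ↓ i) * y ^ k)
    T₁ = stirlingFalling n (suc i) y
    T₀ = stirlingFalling n i y
    split : ∀ k → + stir1 n k * (+ (suc k ↓ suc i) * (y * y ^ k)) ≡ y * f₁ k + (+ suc i * y) * f₀ k
    split k = begin
      + stir1 n k * (+ (suc k ↓ suc i) * (y * y ^ k))                      ≡⟨ cong (λ t → + stir1 n k * (t * (y * y ^ k))) pascal ⟩
      + stir1 n k * ((+ (k ↓ suc i) + + suc i * + (k ↓ i)) * (y * y ^ k))  ≡⟨ lemma′ (+ stir1 n k) (+ (k ↓ suc i)) (+ suc i) (+ (k ↓ i)) y (y ^ k) ⟩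
      y * f₁ k + (+ suc i * y) * f₀ k                                      ∎
      where
      pascal : + (suc k ↓ suc i) ≡ + (k ↓ suc i) + + suc i * + (k ↓ i)
      pascal = trans (cong +_ (↓-pascal k i)) (trans (ℤ.pos-+ (k ↓ suc i) _) (cong (λ t → + (k ↓ suc i) + t) (ℤ.pos-* (suc i) (k ↓ i))))
      lemma′ : ∀ s g m f y a → s * ((g + m * f) * (y * a)) ≡ y * (s * (g * a)) + (m * y) * (s * (f * a))
      lemma′ = solve-∀
    lemma : ∀ n y t r → n * t + (y * t + r) ≡ (y + n) * t + r
    lemma = solve-∀

module _ where
  open import Data.Integer using (_+_; _*_; _^_)
  open import Data.Integer.Divisibility.Signed using (_∣_; ∣m∣n⇒∣m+n; ∣n⇒∣m*n)
  open import Data.List using ([]; _∷_)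
  open import Data.Bool using (true; false)
  open ≡-Reasoning

  data FallingSpan (d : ℕ) : (ℕ → ℤ) → Set where
    basis : ∀ i → i ≤ d → FallingSpan d (λ k → + (k ↓ i))
    add   : ∀ {g h} → FallingSpan d g → FallingSpan d h → FallingSpan d (λ k → g k + h k)
    scale : ∀ {g} c → FallingSpan d g → FallingSpan d (λ k → c * g k)
    ext  : ∀ {g h} → FallingSpan d g → (∀ k → g k ≡ h k) → FallingSpan d h

  FallingSpan-*k : ∀ {d g} → FallingSpan d g → FallingSpan (suc d) (λ k → + k * g k)
  FallingSpan-*k (basis i i≤d) = ext (add (basis (suc i) (s≤s i≤d)) (scale (+ i) (basis i (ℕ.m≤n⇒m≤1+n i≤d)))) k*k↓i
    where
    k*k↓i : ∀ k → + (k ↓ suc i) + + i * + (k ↓ i) ≡ + k * + (k ↓ i)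
    k*k↓i k = begin
      + (k ↓ suc i) + + i * + (k ↓ i)    ≡⟨ cong (λ t → + (k ↓ suc i) + t) (ℤ.pos-* i (k ↓ i)) ⟨
      + (k ↓ suc i) + + (i ℕ.* (k ↓ i))  ≡⟨ ℤ.pos-+ (k ↓ suc i) _ ⟨
      + (k ↓ suc i ℕ.+ i ℕ.* (k ↓ i))    ≡⟨ cong +_ (↓-suc k i) ⟩
      + (k ℕ.* (k ↓ i))                  ≡⟨ ℤ.pos-* k (k ↓ i) ⟩
      + k * + (k ↓ i)                    ∎
  FallingSpan-*k (add {g} {h} sg sh) = ext (add (FallingSpan-*k sg) (FallingSpan-*k sh)) (λ k → sym (ℤ.*-distribˡ-+ (+ k) (g k) (h k)))
  FallingSpan-*k (scale {g} c sg)    = ext (scale c (FallingSpan-*k sg)) (λ k → lemma c (+ k) (g k))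
    where
    lemma : ∀ c k g → c * (k * g) ≡ k * (c * g)
    lemma = solve-∀
  FallingSpan-*k (ext sg g≡h)       = ext (FallingSpan-*k sg) (λ k → cong (+ k *_) (g≡h k))

  allZero⇒eval≡0 : ∀ cs → allZero cs ≡ true → ∀ x → eval cs x ≡ 0ℤ
  allZero⇒eval≡0 []              _  x = refl
  allZero⇒eval≡0 (+ zero ∷ cs)   az x = begin
    0ℤ + x * eval cs x  ≡⟨ ℤ.+-identityˡ _ ⟩
    x * eval cs x       ≡⟨ cong (x *_) (allZero⇒eval≡0 cs az x) ⟩
    x * 0ℤ              ≡⟨ ℤ.*-zeroʳ x ⟩
    0ℤ                  ∎

  eval∈FallingSpan : ∀ f → FallingSpan (deg f) (λ k → eval f (+ k))
  eval∈FallingSpan []       = ext (scale 0ℤ (basis 0 z≤n)) (λ _ → refl)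
  eval∈FallingSpan (c ∷ cs) with allZero cs in az
  ... | true  = ext (scale c (basis 0 z≤n)) (λ k → begin
    c * 1ℤ        ≡⟨ ℤ.*-identityʳ c ⟩
    c             ≡⟨ ℤ.+-identityʳ c ⟨
    c + 0ℤ        ≡⟨ cong (λ t → c + t) (ℤ.*-zeroʳ (+ k)) ⟨
    c + + k * 0ℤ  ≡⟨ cong (λ t → c + + k * t) (allZero⇒eval≡0 cs az (+ k)) ⟨
    c + + k * eval cs (+ k) ∎)
  ... | false = add (ext (scale c (basis 0 z≤n)) (λ k → ℤ.*-identityʳ c)) (FallingSpan-*k (eval∈FallingSpan cs))

  ∣-∑-stirling₁-FallingSpan : ∀ {e d g} n → (∀ i → i ≤ d → ∀ y → e ∣ stirlingFalling n i y) →
                              FallingSpan d g → ∀ y → e ∣ ∑ (suc n) (λ k → + stir1 n k * g k * y ^ k)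
  ∣-∑-stirling₁-FallingSpan n e∣basis (basis i i≤d) y =
    subst (_ ∣_) (∑-cong (suc n) (λ k _ → sym (ℤ.*-assoc (+ stir1 n k) _ _))) (e∣basis i i≤d y)
  ∣-∑-stirling₁-FallingSpan n e∣basis (add {g} {h} sg sh) y =
    subst (_ ∣_) (trans (sym (∑-distrib-+ (suc n) _ _)) (∑-cong (suc n) (λ k _ → lemma (+ stir1 n k) (g k) (h k) (y ^ k))))
      (∣m∣n⇒∣m+n (∣-∑-stirling₁-FallingSpan n e∣basis sg y) (∣-∑-stirling₁-FallingSpan n e∣basis sh y))
    where
    lemma : ∀ s a b x → s * a * x + s * b * x ≡ s * (a + b) * x
    lemma = solve-∀
  ∣-∑-stirling₁-FallingSpan n e∣basis (scale {g} c sg) y =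
    subst (_ ∣_) (trans (sym (*-distribˡ-∑ (suc n) c _)) (∑-cong (suc n) (λ k _ → lemma c (+ stir1 n k) (g k) (y ^ k))))
      (∣n⇒∣m*n c (∣-∑-stirling₁-FallingSpan n e∣basis sg y))
    where
    lemma : ∀ c s a x → c * (s * a * x) ≡ s * (c * a) * x
    lemma = solve-∀
  ∣-∑-stirling₁-FallingSpan n e∣basis (ext sg g≡h) y =
    subst (_ ∣_) (∑-cong (suc n) (λ k _ → cong (λ t → + stir1 n k * t * y ^ k) (g≡h k))) (∣-∑-stirling₁-FallingSpan n e∣basis sg y)

module _ where
  open import Data.Nat using (_*_; _≟_)
  open import Data.Nat.Properties
  open import Data.Fin using (Fin; toℕ; punchIn)
  open import Data.Fin.Properties using (punchIn-injective; punchInᵢ≢i; any?)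
  open import Data.Product using (_×_; _,_; proj₁; proj₂)
  open import Function using (_∘_)
  open import Function.Definitions using (Injective)
  open import Relation.Nullary using (yes; no; contradiction)
  open import Algebra.Properties.CommutativeMonoid.Sum *-1-commutativeMonoid
    using () renaming (sum to product; sum-remove to product-remove)

  ∏≡product : ∀ i (V : ℕ → ℕ) → ∏ i V ≡ product (V ∘ toℕ {i})
  ∏≡product zero    V = refl
  ∏≡product (suc i) V = trans (∏-head i V) (cong (V 0 *_) (∏≡product i (V ∘ suc)))

  product-injective≤↓ : ∀ n {i} (v : Fin i → ℕ) → (∀ j → 1 ≤ v j × v j ≤ n) → Injective _≡_ _≡_ v → product v ≤ n ↓ i
  product-injective≤↓ zero    {zero}  v _      _   = ≤-refl
  product-injective≤↓ zero    {suc i} v bounds _   = contradiction (≤-trans (proj₁ (bounds Fin.zero)) (proj₂ (bounds Fin.zero))) λ ()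
  product-injective≤↓ (suc n) {i}     v bounds inj with any? (λ j → v j ≟ suc n)
  ... | no ∄j = ≤-trans (product-injective≤↓ n v bounds′ inj) (↓-monoˡ-≤ n i)
    where
    bounds′ : ∀ j → 1 ≤ v j × v j ≤ n
    bounds′ j = proj₁ (bounds j) , ≤-pred (≤∧≢⇒< (proj₂ (bounds j)) (λ vj≡1+n → ∄j (j , vj≡1+n)))
  product-injective≤↓ (suc n) {suc i} v bounds inj | yes (j₀ , vj₀≡1+n) = begin
    product v                         ≡⟨ product-remove {i = j₀} v ⟩
    v j₀ * product (v ∘ punchIn j₀)   ≡⟨ cong (_* product (v ∘ punchIn j₀)) vj₀≡1+n ⟩
    suc n * product (v ∘ punchIn j₀)  ≤⟨ *-monoʳ-≤ (suc n) (product-injective≤↓ n (v ∘ punchIn j₀) bounds′ inj′) ⟩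
    suc n * (n ↓ i)                   ∎
    where
    open ≤-Reasoning
    inj′ : Injective _≡_ _≡_ (v ∘ punchIn j₀)
    inj′ {j} {k} e = punchIn-injective j₀ j k (inj e)
    bounds′ : ∀ j → 1 ≤ v (punchIn j₀ j) × v (punchIn j₀ j) ≤ n
    bounds′ j = proj₁ (bounds (punchIn j₀ j)) , ≤-pred (≤∧≢⇒< (proj₂ (bounds (punchIn j₀ j)))
                  (λ e → punchInᵢ≢i j₀ j (inj (trans e (sym vj₀≡1+n)))))

argmin : ∀ (f : ℕ → ℕ) d → ∃ λ i₀ → i₀ ≤ d × (∀ i → i ≤ d → f i₀ ≤ f i)
argmin f zero    = 0 , z≤n , λ { zero z≤n → ℕ.≤-refl }
argmin f (suc d) with argmin f d
... | i₀ , i₀≤d , i₀-min = choose (f i₀ ℕ.≤? f (suc d))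
  where
  choose : Dec (f i₀ ≤ f (suc d)) → ∃ λ j → j ≤ suc d × (∀ i → i ≤ suc d → f j ≤ f i)
  choose (yes fi₀≤) = i₀ , ℕ.m≤n⇒m≤1+n i₀≤d , below
    where
    below : ∀ i → i ≤ suc d → f i₀ ≤ f i
    below i i≤1+d with ℕ.m≤n⇒m<n∨m≡n i≤1+d
    ... | inj₁ i<1+d = i₀-min i (ℕ.≤-pred i<1+d)
    ... | inj₂ refl  = fi₀≤
  choose (no fi₀≰) = suc d , ℕ.≤-refl , below
    where
    below : ∀ i → i ≤ suc d → f (suc d) ≤ f i
    below i i≤1+d with ℕ.m≤n⇒m<n∨m≡n i≤1+d
    ... | inj₁ i<1+d = ℕ.≤-trans (ℕ.<⇒≤ (ℕ.≰⇒> fi₀≰)) (i₀-min i (ℕ.≤-pred i<1+d))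
    ... | inj₂ refl  = ℕ.≤-refl

-- Fermat's little theorem and sums over the units modulo p

module _ (p₀ : ℕ) (p-prime : Prime (suc (suc p₀))) where

  p p-1 : ℕ
  p   = suc (suc p₀)
  p-1 = suc p₀

  module _ where
    open import Data.Nat using (_!)
    open import Data.Nat.Divisibility using (_∣_; _∤_)
    open import Data.Nat.Combinatorics using (_C_)

    0<b<p⇒p∤b : ∀ {b} → 0 < b → b < p → p ∤ b
    0<b<p⇒p∤b {suc b} _ b<p p∣b = ℕ.<⇒≱ b<p (ℕ.∣⇒≤ p∣b)

    p∤1 : p ∤ 1
    p∤1 = 0<b<p⇒p∤b (s≤s z≤n) (s≤s (s≤s z≤n))

    p∤p-1 : p ∤ p-1
    p∤p-1 = 0<b<p⇒p∤b (s≤s z≤n) ℕ.≤-refl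

    j<p⇒p∤j! : ∀ {j} → j < p → p ∤ j !
    j<p⇒p∤j! {zero}  _   = p∤1
    j<p⇒p∤j! {suc j} j<p p∣j! with euclidsLemma (suc j) (j !) p-prime p∣j!
    ... | inj₁ p∣1+j = 0<b<p⇒p∤b (s≤s z≤n) j<p p∣1+j
    ... | inj₂ p∣j!  = j<p⇒p∤j! (ℕ.<-trans (ℕ.n<1+n j) j<p) p∣j!

    p∣pCj : ∀ {j} → 0 < j → j < p → p ∣ p C j
    p∣pCj {suc j} _ j<p with euclidsLemma (p C suc j) (suc j !) p-prime
                               (subst (p ∣_) (↓≡C*! p (suc j)) (ℕ.m∣m*n (p-1 ↓ j)))
    ... | inj₁ p∣pCj = p∣pCj
    ... | inj₂ p∣j!  = contradiction p∣j! (j<p⇒p∤j! j<p)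

  module _ where
    open import Data.Integer using (_+_; _*_; -_; _-_; _^_)
    open import Data.Nat.Combinatorics using (_C_; nCn≡1)
    open import Data.Integer.Divisibility.Signed
      using (_∣_; divides; ∣-trans; ∣ᵤ⇒∣; ∣⇒∣ᵤ; ∣m∣n⇒∣m+n; ∣m⇒∣-m; ∣n⇒∣m*n; ∣m⇒∣m*n; *-cancelʳ-∣)

    euclidsLemmaℤ : ∀ {x y} → + p ∣ x * y → + p ∣ x ⊎ + p ∣ y
    euclidsLemmaℤ {x} {y} p∣xy with euclidsLemma ℤ.∣ x ∣ ℤ.∣ y ∣ p-prime (subst (p ℕ.∣_) (ℤ.abs-* x y) (∣⇒∣ᵤ p∣xy))
    ... | inj₁ p∣x = inj₁ (∣ᵤ⇒∣ p∣x)
    ... | inj₂ p∣y = inj₂ (∣ᵤ⇒∣ p∣y)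

    p^k∣xy⇒p^k∣y : ∀ k {x y} → ¬ (+ p ∣ x) → + (p ℕ.^ k) ∣ x * y → + (p ℕ.^ k) ∣ y
    p^k∣xy⇒p^k∣y zero    {x} {y} _   _     = divides y (sym (ℤ.*-identityʳ y))
    p^k∣xy⇒p^k∣y (suc k) {x} {y} p∤x p^k+1∣xy
      with p^k∣xy⇒p^k∣y k p∤x (∣-trans (∣ᵤ⇒∣ (ℕ.n∣m*n p)) p^k+1∣xy)
    ... | divides t refl with euclidsLemmaℤ {x} {t} (*-cancelʳ-∣ (+ (p ℕ.^ k)) {{ℕ.m^n≢0 p k}} p*p^k∣xt*p^k)
      where
      p*p^k∣xt*p^k : + p * + (p ℕ.^ k) ∣ x * t * + (p ℕ.^ k)
      p*p^k∣xt*p^k = subst₂ _∣_ (ℤ.pos-* p (p ℕ.^ k)) (sym (ℤ.*-assoc x t _)) p^k+1∣xy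
    ... | inj₁ p∣x = contradiction p∣x p∤x
    ... | inj₂ (divides s refl) = divides s (trans (ℤ.*-assoc s (+ p) _) (cong (s *_) (sym (ℤ.pos-* p (p ℕ.^ k)))))

    binomial-p : ∀ x → (+ suc x) ^ p ≡ 1ℤ + ∑ p-1 (λ i → + (p C suc i) * (+ x) ^ suc i) + (+ x) ^ p
    binomial-p x = begin
      (+ suc x) ^ p                          ≡⟨ cong (_^ p) (trans (cong +_ (ℕ.+-comm 1 x)) (ℤ.pos-+ x 1)) ⟩
      (+ x + 1ℤ) ^ p                         ≡⟨ binomial (+ x) p ⟩
      ∑ (suc p-1) h + h p                    ≡⟨ cong (_+ h p) (∑-head p-1 h) ⟩
      1ℤ + ∑ p-1 (h ∘ suc) + h p             ≡⟨ cong (λ c → 1ℤ + ∑ p-1 (h ∘ suc) + + c * (+ x) ^ p) (nCn≡1 p) ⟩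
      1ℤ + ∑ p-1 (h ∘ suc) + 1ℤ * (+ x) ^ p  ≡⟨ cong (λ t → 1ℤ + ∑ p-1 (h ∘ suc) + t) (ℤ.*-identityˡ _) ⟩
      1ℤ + ∑ p-1 (h ∘ suc) + (+ x) ^ p       ∎
      where
      open ≡-Reasoning
      h : ℕ → ℤ
      h i = + (p C i) * (+ x) ^ i

    fermat : ∀ x → (+ x) ^ p ≡ + x mod p
    fermat zero    = ≡-mod-reflexive refl
    fermat (suc x) = begin
      (+ suc x) ^ p                                                 ≡⟨ binomial-p x ⟩
      1ℤ + ∑ p-1 (λ i → + (p C suc i) * (+ x) ^ suc i) + (+ x) ^ p  ≈⟨ +-cong-mod (+-cong-mod (≡-mod-reflexive {x = 1ℤ} refl) (∣⇒≡0-mod p∣middle)) (fermat x) ⟩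
      + suc x                                                       ∎
      where
      open ≡-mod-Reasoning p
      p∣middle : + p ∣ ∑ p-1 (λ i → + (p C suc i) * (+ x) ^ suc i)
      p∣middle = ∣-∑ p-1 _ (λ i i<p-1 → ∣m⇒∣m*n _ (∣ᵤ⇒∣ {+ p} {+ (p C suc i)} (p∣pCj (s≤s z≤n) (s≤s i<p-1))))

    fermat-unit : ∀ {b} → ¬ (p ℕ.∣ b) → (+ b) ^ p-1 ≡ 1ℤ mod p
    fermat-unit {b} p∤b with euclidsLemmaℤ {+ b} {(+ b) ^ p-1 - 1ℤ}
                             (subst (+ p ∣_) (lemma (+ b) ((+ b) ^ p-1)) (divides-difference (fermat b)))
      where
      lemma : ∀ b y → b * y - b ≡ b * (y - 1ℤ)
      lemma = solve-∀
    ... | inj₁ p∣b            = contradiction (∣⇒∣ᵤ p∣b) p∤b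
    ... | inj₂ p∣b^[p-1]-1    = mod-by p∣b^[p-1]-1

    fermat-iterate : ∀ N x → (+ x) ^ (p ℕ.^ N) ≡ + x mod p
    fermat-iterate zero    x = ≡-mod-reflexive (ℤ.^-identityʳ (+ x))
    fermat-iterate (suc N) x = begin
      (+ x) ^ (p ℕ.^ suc N)    ≡⟨ ℤ.^-*-assoc (+ x) p (p ℕ.^ N) ⟨
      ((+ x) ^ p) ^ (p ℕ.^ N)  ≈⟨ ^-cong-mod (p ℕ.^ N) (fermat x) ⟩
      (+ x) ^ (p ℕ.^ N)        ≈⟨ fermat-iterate N x ⟩
      + x                      ∎
      where open ≡-mod-Reasoning p

  module _ where
    open import Data.Nat using (_*_; _^_; _%_)
    open import Data.Nat.DivMod using (%-distribˡ-*; m%n%n≡m%n; m<n⇒m%n≡m; m%n<n)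
    open import Algebra.Bundles using (AbelianGroup)
    open import Algebra.Properties.Group (AbelianGroup.group ℤ.+-0-abelianGroup) using (∙-cancelˡ)
    open ≡-Reasoning

    mod-p-inverse : ∀ {c} → ¬ (p ℕ.∣ c) → (c ^ p₀ * c) % p ≡ 1
    mod-p-inverse {c} p∤c = begin
      (c ^ p₀ * c) % p  ≡⟨ cong (_% p) (ℕ.*-comm (c ^ p₀) c) ⟩
      (c ^ p-1) % p     ≡⟨ ≡-mod⇒%≡ (subst (_≡ 1ℤ mod p) (sym (pos-^ c p-1)) (fermat-unit p∤c)) ⟩
      1 % p             ∎

    mul-mod-p-cancel : ∀ {c c′} → (c′ * c) % p ≡ 1 → ∀ {b} → b < p → (c′ * ((c * b) % p)) % p ≡ b
    mul-mod-p-cancel {c} {c′} c′c≡1 {b} b<p = begin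
      (c′ * ((c * b) % p)) % p          ≡⟨ %-distribˡ-* c′ ((c * b) % p) p ⟩
      (c′ % p * ((c * b) % p % p)) % p  ≡⟨ cong (λ t → (c′ % p * t) % p) (m%n%n≡m%n (c * b) p) ⟩
      (c′ % p * ((c * b) % p)) % p      ≡⟨ %-distribˡ-* c′ (c * b) p ⟨
      (c′ * (c * b)) % p                ≡⟨ cong (_% p) (ℕ.*-assoc c′ c b) ⟨
      (c′ * c * b) % p                  ≡⟨ %-distribˡ-* (c′ * c) b p ⟩
      ((c′ * c) % p * (b % p)) % p      ≡⟨ cong (λ t → (t * (b % p)) % p) c′c≡1 ⟩
      (1 * (b % p)) % p                 ≡⟨ cong (_% p) (ℕ.*-identityˡ (b % p)) ⟩
      b % p % p                         ≡⟨ m%n%n≡m%n b p ⟩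
      b % p                             ≡⟨ m<n⇒m%n≡m b<p ⟩
      b                                 ∎

    ∑-mul-mod-p : ∀ {c} → ¬ (p ℕ.∣ c) → ∀ H → ∑ p (λ b → H ((c * b) % p)) ≡ ∑ p H
    ∑-mul-mod-p {c} p∤c H = ∑-reindex p π σ (λ b _ → m%n<n (c * b) p) (λ x _ → m%n<n (c ^ p₀ * x) p)
      (λ b → mul-mod-p-cancel {c} {c ^ p₀} (mod-p-inverse p∤c)) (λ x → mul-mod-p-cancel {c ^ p₀} {c} c*c^p₀≡1) H
      where
      π σ : ℕ → ℕ
      π b = (c * b) % p
      σ x = (c ^ p₀ * x) % p
      c*c^p₀≡1 : (c * c ^ p₀) % p ≡ 1
      c*c^p₀≡1 = trans (cong (_% p) (ℕ.*-comm c (c ^ p₀))) (mod-p-inverse p∤c)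

    ∑-units-mul-mod-p : ∀ {c} → ¬ (p ℕ.∣ c) → ∀ H → ∑ p-1 (λ b → H ((c * suc b) % p)) ≡ ∑ p-1 (H ∘ suc)
    ∑-units-mul-mod-p {c} p∤c H = ∙-cancelˡ (H 0) _ _ (begin
      H 0 + ∑ p-1 (λ b → H ((c * suc b) % p))              ≡⟨ cong (λ b → H (b % p) + ∑ p-1 (λ b → H ((c * suc b) % p))) (ℕ.*-zeroʳ c) ⟨
      H ((c * 0) % p) + ∑ p-1 (λ b → H ((c * suc b) % p))  ≡⟨ ∑-head p-1 (λ b → H ((c * b) % p)) ⟨
      ∑ p (λ b → H ((c * b) % p))                          ≡⟨ ∑-mul-mod-p p∤c H ⟩
      ∑ p H                                                ≡⟨ ∑-head p-1 H ⟩
      H 0 + ∑ p-1 (H ∘ suc)                               ∎)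
      where open import Data.Integer using (_+_)

  module _ where
    open import Data.Integer using (_+_; _*_; -_; _-_; _^_)
    open import Data.Integer.Divisibility.Signed using (_∣_; divides; ∣⇒∣ᵤ; ∣m∣n⇒∣m-n; ∣m+n∣m⇒∣n; ∣n⇒∣m*n)
    open import Data.Nat.Combinatorics using (_C_; nCk≡nC[n∸k]; nC1≡n)
    open import Data.Nat.Induction using (<-rec)

    p∣powerSum : ∀ j → j < p-1 → + p ∣ powerSum p j
    p∣powerSum = <-rec (λ j → j < p-1 → + p ∣ powerSum p j) step
      where
      step : ∀ j → (∀ {i} → i < j → i < p-1 → + p ∣ powerSum p i) → j < p-1 → + p ∣ powerSum p j
      step j IH j<p-1 = [ (λ p∣1+j → contradiction (∣⇒∣ᵤ p∣1+j) (0<b<p⇒p∤b (s≤s z≤n) (s≤s j<p-1))) , id ]′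
                          (euclidsLemmaℤ {+ suc j} {powerSum p j} p∣[1+j]S)
        where
        C[1+j,j]≡1+j : suc j C j ≡ suc j
        C[1+j,j]≡1+j = trans (nCk≡nC[n∸k] (ℕ.n≤1+n j)) (trans (cong (suc j C_) (ℕ.m+n∸n≡m 1 j)) (nC1≡n (suc j)))
        p∣all : + p ∣ ∑ (suc j) (λ i → + (suc j C i) * powerSum p i)
        p∣all = subst (+ p ∣_) (sym (∑-C-powerSum p j)) (divides ((+ p) ^ j) (ℤ.*-comm (+ p) ((+ p) ^ j)))
        p∣lower : + p ∣ ∑ j (λ i → + (suc j C i) * powerSum p i)
        p∣lower = ∣-∑ j _ (λ i i<j → ∣n⇒∣m*n (+ (suc j C i)) (IH i<j (ℕ.<-trans i<j j<p-1)))
        p∣[1+j]S : + p ∣ + suc j * powerSum p j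
        p∣[1+j]S = subst (λ c → + p ∣ + c * powerSum p j) C[1+j,j]≡1+j (∣m+n∣m⇒∣n p∣all p∣lower)

    ^-p-1-periodic : ∀ {d x} → x ^ p-1 ≡ 1ℤ mod d → ∀ j t → x ^ (j ℕ.+ t ℕ.* p-1) ≡ x ^ j mod d
    ^-p-1-periodic {d} {x} x^p-1≡1 j t = begin
      x ^ (j ℕ.+ t ℕ.* p-1)    ≡⟨ ℤ.^-distribˡ-+-* x j (t ℕ.* p-1) ⟩
      x ^ j * x ^ (t ℕ.* p-1)  ≡⟨ cong (λ e → x ^ j * x ^ e) (ℕ.*-comm t p-1) ⟩
      x ^ j * x ^ (p-1 ℕ.* t)  ≡⟨ cong (x ^ j *_) (ℤ.^-*-assoc x p-1 t) ⟨
      x ^ j * (x ^ p-1) ^ t    ≈⟨ *-cong-mod (≡-mod-reflexive {x = x ^ j} refl) (^-cong-mod t x^p-1≡1) ⟩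
      x ^ j * 1ℤ ^ t           ≡⟨ cong (x ^ j *_) (ℤ.^-zeroˡ t) ⟩
      x ^ j * 1ℤ               ≡⟨ ℤ.*-identityʳ (x ^ j) ⟩
      x ^ j                    ∎
      where open ≡-mod-Reasoning d

    ω : ℕ → ℕ → ℤ
    ω N b = (+ b) ^ (p ℕ.^ N)

    ωSum : ℕ → ℕ → ℤ
    ωSum N J = ∑ p-1 (λ b → ω N (suc b) ^ J)

    ω-unit-^-p-1 : ∀ N {b} → ¬ (p ℕ.∣ b) → ω N b ^ p-1 ≡ 1ℤ mod (p ℕ.^ suc N)
    ω-unit-^-p-1 N {b} p∤b = begin
      ((+ b) ^ (p ℕ.^ N)) ^ p-1  ≡⟨ ℤ.^-*-assoc (+ b) (p ℕ.^ N) p-1 ⟩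
      (+ b) ^ (p ℕ.^ N ℕ.* p-1)  ≡⟨ cong ((+ b) ^_) (ℕ.*-comm (p ℕ.^ N) p-1) ⟩
      (+ b) ^ (p-1 ℕ.* p ℕ.^ N)  ≡⟨ ℤ.^-*-assoc (+ b) p-1 (p ℕ.^ N) ⟨
      ((+ b) ^ p-1) ^ (p ℕ.^ N)  ≈⟨ ^-lift-≡-mod-pow N (fermat-unit p∤b) ⟩
      1ℤ ^ (p ℕ.^ N)             ≡⟨ ℤ.^-zeroˡ (p ℕ.^ N) ⟩
      1ℤ                         ∎
      where open ≡-mod-Reasoning (p ℕ.^ suc N)

    ω-mod-p : ∀ N m → ω N m ≡ ω N (m ℕ.% p) mod (p ℕ.^ suc N)
    ω-mod-p N m = ^-lift-≡-mod-pow N (mod-by (divides (+ (m ℕ./ p)) (begin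
      + m - + (m ℕ.% p)                              ≡⟨ cong (λ t → + t - + (m ℕ.% p)) (m≡m%n+[m/n]*n m p) ⟩
      + (m ℕ.% p ℕ.+ m ℕ./ p ℕ.* p) - + (m ℕ.% p)    ≡⟨ cong (_- + (m ℕ.% p)) (ℤ.pos-+ (m ℕ.% p) (m ℕ./ p ℕ.* p)) ⟩
      + (m ℕ.% p) + + (m ℕ./ p ℕ.* p) - + (m ℕ.% p)  ≡⟨ lemma (+ (m ℕ.% p)) (+ (m ℕ./ p ℕ.* p)) ⟩
      + (m ℕ./ p ℕ.* p)                              ≡⟨ ℤ.pos-* (m ℕ./ p) p ⟩
      + (m ℕ./ p) * + p                        ∎)))
      where
      open ≡-Reasoning
      lemma : ∀ a b → a + b - a ≡ b
      lemma = solve-∀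

    ω-multiplicative : ∀ N a b → ω N a * ω N b ≡ ω N (a ℕ.* b)
    ω-multiplicative N a b = trans (sym (^-distribʳ-* (+ a) (+ b) (p ℕ.^ N))) (cong (_^ (p ℕ.^ N)) (sym (ℤ.pos-* a b)))

    ωSum-multiple : ∀ N t → ωSum N (t ℕ.* p-1) ≡ + p-1 mod (p ℕ.^ suc N)
    ωSum-multiple N t = begin
      ∑ p-1 (λ b → ω N (suc b) ^ (t ℕ.* p-1))  ≈⟨ ∑-cong-mod p-1 (λ b b<p-1 → ^-p-1-periodic {x = ω N (suc b)} (ω-unit-^-p-1 N (0<b<p⇒p∤b (s≤s z≤n) (s≤s b<p-1))) 0 t) ⟩
      ∑ p-1 (λ _ → 1ℤ)                         ≡⟨ ∑-const p-1 1ℤ ⟩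
      + p-1 * 1ℤ                               ≡⟨ ℤ.*-identityʳ (+ p-1) ⟩
      + p-1                                    ∎
      where open ≡-mod-Reasoning (p ℕ.^ suc N)

    ωSum-≡-powerSum : ∀ N j t → ωSum N (suc j ℕ.+ t ℕ.* p-1) ≡ powerSum p (suc j) mod p
    ωSum-≡-powerSum N j t = begin
      ∑ p-1 (λ b → ω N (suc b) ^ J)         ≈⟨ ∑-cong-mod p-1 (λ b b<p-1 → ^-cong-mod J (fermat-iterate N (suc b))) ⟩
      ∑ p-1 (λ b → (+ suc b) ^ J)           ≈⟨ ∑-cong-mod p-1 (λ b b<p-1 → ^-p-1-periodic {x = + suc b} (fermat-unit (0<b<p⇒p∤b (s≤s z≤n) (s≤s b<p-1))) (suc j) t) ⟩
      ∑ p-1 (λ b → (+ suc b) ^ suc j)       ≡⟨ ℤ.+-identityˡ _ ⟨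
      0ℤ + ∑ p-1 (λ b → (+ suc b) ^ suc j)  ≡⟨ ∑-head p-1 (λ b → (+ b) ^ suc j) ⟨
      powerSum p (suc j)                    ∎
      where
      open ≡-mod-Reasoning p
      J = suc j ℕ.+ t ℕ.* p-1

    ωSum-square : ∀ N J → ωSum N J * ωSum N J ≡ + p-1 * ωSum N J mod (p ℕ.^ suc N)
    ωSum-square N J = begin
      T * T                                                    ≡⟨ *-distribʳ-∑ p-1 T g ⟩
      ∑ p-1 (λ c → g c * T)                                    ≡⟨ ∑-cong p-1 (λ c _ → *-distribˡ-∑ p-1 (g c) g) ⟨
      ∑ p-1 (λ c → ∑ p-1 (λ b → g c * g b))                    ≡⟨ ∑-cong p-1 (λ c _ → ∑-cong p-1 (λ b _ → product c b)) ⟩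
      ∑ p-1 (λ c → ∑ p-1 (λ b → H (suc c ℕ.* suc b)))          ≈⟨ ∑-cong-mod p-1 (λ c _ → ∑-cong-mod p-1 (λ b _ → ^-cong-mod J (ω-mod-p N (suc c ℕ.* suc b)))) ⟩
      ∑ p-1 (λ c → ∑ p-1 (λ b → H ((suc c ℕ.* suc b) ℕ.% p)))  ≡⟨ ∑-cong p-1 (λ c c<p-1 → ∑-units-mul-mod-p (0<b<p⇒p∤b (s≤s z≤n) (s≤s c<p-1)) H) ⟩
      ∑ p-1 (λ _ → T)                                          ≡⟨ ∑-const p-1 T ⟩
      + p-1 * T                                                ∎
      where
      open ≡-mod-Reasoning (p ℕ.^ suc N)
      T = ωSum N J
      g : ℕ → ℤ
      g b = ω N (suc b) ^ J
      H : ℕ → ℤ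
      H m = ω N m ^ J
      product : ∀ c b → g c * g b ≡ H (suc c ℕ.* suc b)
      product c b = trans (sym (^-distribʳ-* (ω N (suc c)) (ω N (suc b)) J)) (cong (_^ J) (ω-multiplicative N (suc c) (suc b)))

    -- ωSum N J ≡ 0 (mod p), and ωSum N J · (ωSum N J − (p − 1)) ≡ 0 (mod p^(N+1)) with the
    -- second factor prime to p.
    ωSum-non-multiple : ∀ N J → ¬ (p-1 ℕ.∣ J) → + (p ℕ.^ suc N) ∣ ωSum N J
    ωSum-non-multiple N J p-1∤J = p^k∣xy⇒p^k∣y (suc N) p∤T-[p-1] (subst (+ (p ℕ.^ suc N) ∣_) (lemma T (+ p-1)) (divides-difference (ωSum-square N J)))
      where
      T = ωSum N J
      lemma : ∀ t q → t * t - q * t ≡ (t - q) * t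
      lemma = solve-∀
      p∣T : + p ∣ T
      p∣T with J ℕ.% p-1 in J%p-1≡j | m≡m%n+[m/n]*n J p-1
      ... | zero  | _      = contradiction (ℕ.m%n≡0⇒n∣m J p-1 J%p-1≡j) p-1∤J
      ... | suc j | J≡j+tq = ∣-resp-≡-mod (subst (λ e → ωSum N e ≡ powerSum p (suc j) mod p) (sym J≡j+tq) (ωSum-≡-powerSum N j (J ℕ./ p-1)))
                               (p∣powerSum (suc j) (subst (_< p-1) J%p-1≡j (m%n<n J p-1)))
      p∤T-[p-1] : ¬ (+ p ∣ T - + p-1)
      p∤T-[p-1] p∣T-[p-1] = p∤p-1 (∣⇒∣ᵤ (subst (+ p ∣_) (lemma′ T (+ p-1)) (∣m∣n⇒∣m-n p∣T p∣T-[p-1])))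
        where
        lemma′ : ∀ t q → t - (t - q) ≡ q
        lemma′ = solve-∀

    -- Σ_b ω(b)^ρ P(a·ω(b)) = Σₖ cₖ aᵏ ωSum(k + ρ), and ωSum(k + ρ) ≡ (p − 1)·[k ≡ r] (mod p^(M+1)).
    residue-filter : ∀ (c : ℕ → ℤ) n M → (∀ y → + (p ℕ.^ M) ∣ ∑ (suc n) (λ k → c k * y ^ k)) →
                     ∀ a r → + (p ℕ.^ M) ∣ sumRes p-1 r n (λ k → c k * a ^ k)
    residue-filter c n M p^M∣P a r = p^k∣xy⇒p^k∣y M p∤p-1ℤ (∣-resp-≡-mod (≡-mod-sym L≡) p^M∣L)
      where
      g : ℕ → ℤ
      g k = c k * a ^ k
      ρ = natNeg p₀ r
      w : ℕ → ℤ
      w b = ω M (suc b)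
      P : ℤ → ℤ
      P y = ∑ (suc n) (λ k → c k * y ^ k)
      L = ∑ p-1 (λ b → w b ^ ρ * P (a * w b))

      p^M∣L : + (p ℕ.^ M) ∣ L
      p^M∣L = ∣-∑ p-1 _ (λ b _ → ∣n⇒∣m*n (w b ^ ρ) (p^M∣P (a * w b)))

      p∤p-1ℤ : ¬ (+ p ∣ + p-1)
      p∤p-1ℤ p∣p-1 = p∤p-1 (∣⇒∣ᵤ p∣p-1)

      term : ∀ b k → w b ^ ρ * (c k * (a * w b) ^ k) ≡ g k * w b ^ (k ℕ.+ ρ)
      term b k = begin
        w b ^ ρ * (c k * (a * w b) ^ k)      ≡⟨ cong (λ t → w b ^ ρ * (c k * t)) (^-distribʳ-* a (w b) k) ⟩
        w b ^ ρ * (c k * (a ^ k * w b ^ k))  ≡⟨ lemma (w b ^ ρ) (c k) (a ^ k) (w b ^ k) ⟩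
        g k * (w b ^ k * w b ^ ρ)            ≡⟨ cong (g k *_) (ℤ.^-distribˡ-+-* (w b) k ρ) ⟨
        g k * w b ^ (k ℕ.+ ρ)                ∎
        where
        open ≡-Reasoning
        lemma : ∀ x c a y → x * (c * (a * y)) ≡ c * a * (y * x)
        lemma = solve-∀

      L-expand : L ≡ ∑ (suc n) (λ k → g k * ωSum M (k ℕ.+ ρ))
      L-expand = begin
        L                                                                ≡⟨ ∑-cong p-1 (λ b _ → sym (*-distribˡ-∑ (suc n) (w b ^ ρ) _)) ⟩
        ∑ p-1 (λ b → ∑ (suc n) (λ k → w b ^ ρ * (c k * (a * w b) ^ k)))  ≡⟨ ∑-comm p-1 (suc n) _ ⟩
        ∑ (suc n) (λ k → ∑ p-1 (λ b → w b ^ ρ * (c k * (a * w b) ^ k)))  ≡⟨ ∑-cong (suc n) (λ k _ → ∑-cong p-1 (λ b _ → term b k)) ⟩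
        ∑ (suc n) (λ k → ∑ p-1 (λ b → g k * w b ^ (k ℕ.+ ρ)))            ≡⟨ ∑-cong (suc n) (λ k _ → *-distribˡ-∑ p-1 (g k) _) ⟩
        ∑ (suc n) (λ k → g k * ωSum M (k ℕ.+ ρ))                         ∎
        where open ≡-Reasoning

      filtered-term : ∀ k → g k * ωSum M (k ℕ.+ ρ) ≡ + p-1 * restrict p-1 r g k mod (p ℕ.^ suc M)
      filtered-term k with p-1 ℕ.∣? ℤ.∣ + k - r ∣
      ... | yes p-1∣k-r with Equivalence.to (∣k-r∣⇔∣k+natNeg p₀ k r) p-1∣k-r
      ...   | ℕ.divides t k+ρ≡tq = begin
        g k * ωSum M (k ℕ.+ ρ)    ≡⟨ cong (λ e → g k * ωSum M e) k+ρ≡tq ⟩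
        g k * ωSum M (t ℕ.* p-1)  ≈⟨ *-cong-mod (≡-mod-reflexive {x = g k} refl) (ωSum-multiple M t) ⟩
        g k * + p-1               ≡⟨ ℤ.*-comm (g k) (+ p-1) ⟩
        + p-1 * g k               ∎
        where open ≡-mod-Reasoning (p ℕ.^ suc M)
      filtered-term k | no p-1∤k-r = begin
        g k * ωSum M (k ℕ.+ ρ)  ≈⟨ *-cong-mod (≡-mod-reflexive {x = g k} refl) (∣⇒≡0-mod (ωSum-non-multiple M (k ℕ.+ ρ) (p-1∤k-r ∘ Equivalence.from (∣k-r∣⇔∣k+natNeg p₀ k r)))) ⟩
        g k * 0ℤ                ≡⟨ ℤ.*-zeroʳ (g k) ⟩
        0ℤ                      ≡⟨ ℤ.*-zeroʳ (+ p-1) ⟨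
        + p-1 * 0ℤ              ∎
        where open ≡-mod-Reasoning (p ℕ.^ suc M)

      L≡ : L ≡ + p-1 * sumRes p-1 r n g mod (p ℕ.^ M)
      L≡ = ≡-mod-∣ (ℕ.n∣m*n p) (begin
        L                                             ≡⟨ L-expand ⟩
        ∑ (suc n) (λ k → g k * ωSum M (k ℕ.+ ρ))      ≈⟨ ∑-cong-mod (suc n) (λ k _ → filtered-term k) ⟩
        ∑ (suc n) (λ k → + p-1 * restrict p-1 r g k)  ≡⟨ *-distribˡ-∑ (suc n) (+ p-1) _ ⟩
        + p-1 * ∑ (suc n) (restrict p-1 r g)          ≡⟨ cong (+ p-1 *_) (sumRes≡∑ p-1 r n g) ⟨
        + p-1 * sumRes p-1 r n g                    ∎)
        where open ≡-mod-Reasoning (p ℕ.^ suc M)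

  -- p-adic valuations and the binomial bound

  module _ where
    open import Data.Nat using (_+_; _*_; _∸_; _^_; _!)
    open import Data.Nat.Properties
    open import Data.Nat.Divisibility using (_∣_; _∤_; _∣?_; divides; ∣-trans; n∣m*n; ∣⇒≤; *-monoˡ-∣; *-cancelˡ-∣; 1∣_)

    p^-mono-∣ : ∀ {a b} → a ≤ b → p ^ a ∣ p ^ b
    p^-mono-∣ {a} {b} a≤b = divides (p ^ (b ∸ a)) (begin
      p ^ b                ≡⟨ cong (p ^_) (m+[n∸m]≡n a≤b) ⟨
      p ^ (a + (b ∸ a))    ≡⟨ ^-distribˡ-+-* p a (b ∸ a) ⟩
      p ^ a * p ^ (b ∸ a)  ≡⟨ *-comm (p ^ a) _ ⟩
      p ^ (b ∸ a) * p ^ a   ∎)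
      where open ≡-Reasoning

    k<p^k : ∀ k → k < p ^ k
    k<p^k zero    = s≤s z≤n
    k<p^k (suc k) = begin-strict
      suc k          <⟨ s≤s (k<p^k k) ⟩
      suc (p ^ k)    ≤⟨ +-monoˡ-≤ (p ^ k) (m^n>0 p k) ⟩
      p ^ k + p ^ k  ≤⟨ +-monoʳ-≤ (p ^ k) (m≤m+n (p ^ k) _) ⟩
      p ^ suc k      ∎
      where open ≤-Reasoning

    p^[1+t]∣? : ∀ m t → Dec (p ^ suc t ∣ m)
    p^[1+t]∣? m t = p ^ suc t ∣? m

    p^[2+t]∣⇒p^[1+t]∣ : ∀ m t → p ^ suc (suc t) ∣ m → p ^ suc t ∣ m
    p^[2+t]∣⇒p^[1+t]∣ m t = ∣-trans (n∣m*n p)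

    -- ord_p j for j > 0.
    ν : ℕ → ℕ
    ν j = count (p^[1+t]∣? j) j

    p^ν∣ : ∀ j → p ^ ν j ∣ j
    p^ν∣ j with ν j | proj₁ (count-downward (p^[1+t]∣? j) (p^[2+t]∣⇒p^[1+t]∣ j) j)
    ... | zero  | _       = 1∣ j
    ... | suc t | below   = below t ≤-refl

    p^[1+ν]∤ : ∀ {j} → 0 < j → p ^ suc (ν j) ∤ j
    p^[1+ν]∤ {j} 0<j p^[1+ν]∣j = <-irrefl refl (proj₂ (count-downward (p^[1+t]∣? j) (p^[2+t]∣⇒p^[1+t]∣ j) j) (ν j) ν<j p^[1+ν]∣j)
      where
      ν<j : ν j < j
      ν<j = <-≤-trans (<-trans (n<1+n (ν j)) (k<p^k (suc (ν j)))) (∣⇒≤ {{ℕ.>-nonZero 0<j}} p^[1+ν]∣j)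

    unitPart : ℕ → ℕ
    unitPart j = _∣_.quotient (p^ν∣ j)

    unitPart*p^ν : ∀ j → j ≡ unitPart j * p ^ ν j
    unitPart*p^ν j = _∣_.equality (p^ν∣ j)

    p∤unitPart : ∀ {j} → 0 < j → p ∤ unitPart j
    p∤unitPart {j} 0<j p∣u = p^[1+ν]∤ 0<j (subst (p ^ suc (ν j) ∣_) (sym (unitPart*p^ν j)) (*-monoˡ-∣ (p ^ ν j) p∣u))

    unitPart-pos : ∀ {j} → 0 < j → 0 < unitPart j
    unitPart-pos {j} 0<j with unitPart j | unitPart*p^ν j
    ... | zero  | j≡0 = contradiction j≡0 (>⇒≢ 0<j)
    ... | suc _ | _   = s≤s z≤n

    unitPart≤ : ∀ j → unitPart j ≤ j
    unitPart≤ j = ≤-trans (m≤m*n (unitPart j) (p ^ ν j) {{m^n≢0 p (ν j)}}) (≤-reflexive (sym (unitPart*p^ν j)))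

    ν! : ℕ → ℕ
    ν! i = ∑ℕ i (λ j → ν (suc j))

    unitPart! : ℕ → ℕ
    unitPart! i = ∏ i (λ j → unitPart (suc j))

    !≡p^ν!*unitPart! : ∀ i → i ! ≡ p ^ ν! i * unitPart! i
    !≡p^ν!*unitPart! zero    = refl
    !≡p^ν!*unitPart! (suc i) = begin
      suc i * i !                                                  ≡⟨ cong₂ _*_ (unitPart*p^ν (suc i)) (!≡p^ν!*unitPart! i) ⟩
      unitPart (suc i) * p ^ ν (suc i) * (p ^ ν! i * unitPart! i)  ≡⟨ lemma (unitPart (suc i)) (p ^ ν (suc i)) (p ^ ν! i) (unitPart! i) ⟩
      p ^ ν! i * p ^ ν (suc i) * (unitPart! i * unitPart (suc i))  ≡⟨ cong (_* unitPart! (suc i)) (^-distribˡ-+-* p (ν! i) (ν (suc i))) ⟨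
      p ^ ν! (suc i) * unitPart! (suc i)                           ∎
      where
      open ≡-Reasoning
      lemma : ∀ a b c d → a * b * (c * d) ≡ c * b * (d * a)
      lemma = ℕ-solve-∀

    p∤unitPart! : ∀ i → p ∤ unitPart! i
    p∤unitPart! zero    = p∤1
    p∤unitPart! (suc i) p∣ with euclidsLemma (unitPart! i) (unitPart (suc i)) p-prime p∣
    ... | inj₁ p∣u! = p∤unitPart! i p∣u!
    ... | inj₂ p∣u  = p∤unitPart {suc i} (s≤s z≤n) p∣u

    unitPart!-pos : ∀ i → 0 < unitPart! i
    unitPart!-pos zero    = s≤s z≤n
    unitPart!-pos (suc i) = *-mono-< (unitPart!-pos i) (unitPart-pos {suc i} (s≤s z≤n))

    p^u∣n!⇒u≤ν! : ∀ n u → p ^ u ∣ n ! → u ≤ ν! n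
    p^u∣n!⇒u≤ν! n u p^u∣n! with u ≤? ν! n
    ... | yes u≤ν! = u≤ν!
    ... | no  u≰ν! = contradiction (*-cancelˡ-∣ (p ^ ν! n) {{m^n≢0 p (ν! n)}} p^ν!*p∣) (p∤unitPart! n)
      where
      p^ν!*p∣ : p ^ ν! n * p ∣ p ^ ν! n * unitPart! n
      p^ν!*p∣ = subst₂ _∣_ (*-comm p (p ^ ν! n)) (!≡p^ν!*unitPart! n) (∣-trans (p^-mono-∣ (≰⇒> u≰ν!)) p^u∣n!)

  module _ where
    open import Data.Integer using (_+_; _*_)
    open import Data.Integer.Divisibility.Signed using (_∣_; divides; ∣-trans; ∣ᵤ⇒∣; ∣m∣n⇒∣m+n; ∣m⇒∣m*n)

    p^-∣-* : ∀ a b {e x y} → + (p ℕ.^ a) ∣ x → + (p ℕ.^ b) ∣ y → e ≤ a ℕ.+ b → + (p ℕ.^ e) ∣ x * y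
    p^-∣-* a b {e} p^a∣x p^b∣y e≤a+b =
      ∣-trans (∣ᵤ⇒∣ (subst (p ℕ.^ e ℕ.∣_) (trans (ℕ.^-distribˡ-+-* p a b) refl) (p^-mono-∣ e≤a+b)))
              (subst (_∣ _) (sym (ℤ.pos-* (p ℕ.^ a) (p ℕ.^ b))) (*-pres-∣ p^a∣x p^b∣y))

    -- min(T, ord_p m) for m > 0.
    νcap : ℕ → ℕ → ℕ
    νcap T m = count (p^[1+t]∣? m) T

    p^νcap∣ : ∀ T m → p ℕ.^ νcap T m ℕ.∣ m
    p^νcap∣ T m with νcap T m | proj₁ (count-downward (p^[1+t]∣? m) (p^[2+t]∣⇒p^[1+t]∣ m) T)
    ... | zero  | _     = ℕ.1∣ m
    ... | suc t | below = below t ℕ.≤-refl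

    excess : ℕ → ℤ → ℕ → ℕ → ℕ
    excess T y n i = ∑ℕ T (λ t → multiplesIn y (p ℕ.^ suc t) n ℕ.∸ i)

    excess-suc : ∀ T y n i → excess T y (suc n) i ≤ excess T y n i ℕ.+ νcap T ℤ.∣ y + + n ∣
    excess-suc T y n i = ℕ.≤-trans (∑ℕ-mono T (λ t _ → ∸-+-≤ (multiplesIn y (p ℕ.^ suc t) n) _ i)) (ℕ.≤-reflexive (∑ℕ-distrib-+ T _ _))
      where
      ∸-+-≤ : ∀ a b i → (a ℕ.+ b) ℕ.∸ i ≤ (a ℕ.∸ i) ℕ.+ b
      ∸-+-≤ a       b zero    = ℕ.≤-refl
      ∸-+-≤ zero    b (suc i) = ℕ.m∸n≤m b (suc i)
      ∸-+-≤ (suc a) b (suc i) = ∸-+-≤ a b i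

    excess-suc-suc : ∀ T y n i → excess T y (suc n) (suc i) ≤ excess T y n i
    excess-suc-suc T y n i = ∑ℕ-mono T (λ t _ → ∸-≤ (multiplesIn y (p ℕ.^ suc t) n) (indicator≤1 (p ℕ.^ suc t ℕ.∣? ℤ.∣ y + + n ∣)))
      where
      ∸-≤ : ∀ a {b} → b ≤ 1 → (a ℕ.+ b) ℕ.∸ suc i ≤ a ℕ.∸ i
      ∸-≤ a b≤1 = ℕ.≤-trans (ℕ.∸-monoˡ-≤ (suc i) (ℕ.+-monoʳ-≤ a b≤1)) (ℕ.≤-reflexive (cong (ℕ._∸ suc i) (ℕ.+-comm a 1)))

    -- stirlingFalling n i y is i!·yⁱ times the sum over i-subsets S of {0, …, n − 1} of ∏_{j ∉ S} (y + j),
    -- and each such product omits at most i of the multiples of p^(t+1) among y, …, y + n − 1.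
    p^∣stirlingFalling : ∀ T n i y → + (p ℕ.^ (ν! i ℕ.+ excess T y n i)) ∣ stirlingFalling n i y
    p^∣stirlingFalling T zero    zero    y = subst (λ e → + (p ℕ.^ e) ∣ 1ℤ) (sym (∑ℕ-zero T (λ _ _ → refl))) (divides 1ℤ refl)
    p^∣stirlingFalling T zero    (suc i) y = divides 0ℤ refl
    p^∣stirlingFalling T (suc n) zero    y = ∣-respʳ (sym (stirlingFalling-suc-0 n y))
      (p^-∣-* (νcap T ℤ.∣ y + + n ∣) (excess T y n 0) (∣ᵤ⇒∣ {_} {y + + n} (p^νcap∣ T ℤ.∣ y + + n ∣)) (p^∣stirlingFalling T n 0 y)
              (ℕ.≤-trans (excess-suc T y n 0) (ℕ.≤-reflexive (ℕ.+-comm (excess T y n 0) _))))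
    p^∣stirlingFalling T (suc n) (suc i) y = ∣-respʳ (sym (stirlingFalling-suc n i y)) (∣m∣n⇒∣m+n via-n via-i)
      where
      via-n : + (p ℕ.^ (ν! (suc i) ℕ.+ excess T y (suc n) (suc i))) ∣ (y + + n) * stirlingFalling n (suc i) y
      via-n = p^-∣-* (νcap T ℤ.∣ y + + n ∣) (ν! (suc i) ℕ.+ excess T y n (suc i)) (∣ᵤ⇒∣ {_} {y + + n} (p^νcap∣ T ℤ.∣ y + + n ∣)) (p^∣stirlingFalling T n (suc i) y)
        (ℕ.≤-trans (ℕ.+-monoʳ-≤ (ν! (suc i)) (excess-suc T y n (suc i)))
                   (ℕ.≤-reflexive (lemma (ν! (suc i)) (excess T y n (suc i)) (νcap T ℤ.∣ y + + n ∣))))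
        where
        lemma : ∀ a b c → a ℕ.+ (b ℕ.+ c) ≡ c ℕ.+ (a ℕ.+ b)
        lemma = ℕ-solve-∀
      via-i : + (p ℕ.^ (ν! (suc i) ℕ.+ excess T y (suc n) (suc i))) ∣ (+ suc i * y) * stirlingFalling n i y
      via-i = p^-∣-* (ν (suc i)) (ν! i ℕ.+ excess T y n i) (∣m⇒∣m*n y (∣ᵤ⇒∣ {_} {+ suc i} (p^ν∣ (suc i)))) (p^∣stirlingFalling T n i y)
        (ℕ.≤-trans (ℕ.+-monoʳ-≤ (ν! (suc i)) (excess-suc-suc T y n i))
                   (ℕ.≤-reflexive (lemma (ν! i) (ν (suc i)) (excess T y n i))))
        where
        lemma : ∀ a b c → a ℕ.+ b ℕ.+ c ≡ b ℕ.+ (a ℕ.+ c)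
        lemma = ℕ-solve-∀

  module _ where
    open import Data.Nat using (_+_; _*_; _∸_; _^_; _!; _⊓_; _/_; _≤?_; >-nonZero)
    open import Data.Nat.Properties
    open import Data.Nat.Divisibility using (_∣_; _∤_; _∣?_; divides)
    open import Data.Nat.Combinatorics using (_C_)
    open import Data.Nat.DivMod using (m/n*n≤m; m/n≤m; /-monoʳ-≤)
    open import Data.Fin using (toℕ)
    open import Data.Fin.Properties using (toℕ<n; toℕ-injective)
    open import Algebra.Properties.CommutativeMonoid.Sum *-1-commutativeMonoid using () renaming (sum to product)

    ⌊_/p^_⌋ : ℕ → ℕ → ℕ
    ⌊ n /p^ t ⌋ = (n / p ^ t) {{m^n≢0 p t}}

    module _ (n : ℕ) where

      p^[1+t]*J≤? : ∀ J t → Dec (p ^ suc t * J ≤ n)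
      p^[1+t]*J≤? J t = p ^ suc t * J ≤? n

      τ : ℕ → ℕ
      τ J = count (p^[1+t]*J≤? J) n

      p^[2+t]*J≤n⇒p^[1+t]*J≤n : ∀ J t → p ^ suc (suc t) * J ≤ n → p ^ suc t * J ≤ n
      p^[2+t]*J≤n⇒p^[1+t]*J≤n J t = ≤-trans (*-monoˡ-≤ J (m≤n*m (p ^ suc t) p))

      module _ {J : ℕ} (0<J : 0 < J) where
        private
          τ-spec = count-downward (p^[1+t]*J≤? J) (p^[2+t]*J≤n⇒p^[1+t]*J≤n J) n

        p^τ*J≤n : J ≤ n → p ^ τ J * J ≤ n
        p^τ*J≤n J≤n with τ J | proj₁ τ-spec
        ... | zero  | _     = subst (_≤ n) (sym (+-identityʳ J)) J≤n
        ... | suc t | below = below t ≤-refl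

        p^[1+τ]*J≰n : ¬ (p ^ suc (τ J) * J ≤ n)
        p^[1+τ]*J≰n p^[1+τ]*J≤n = <-irrefl refl (proj₂ τ-spec (τ J) τ<n p^[1+τ]*J≤n)
          where
          τ<n : τ J < n
          τ<n = ≤-trans (<-trans (n<1+n (τ J)) (k<p^k (suc (τ J)))) (≤-trans (m≤m*n _ J {{>-nonZero 0<J}}) p^[1+τ]*J≤n)

    p^a*x≡p^b*y⇒p∣x : ∀ {a b x y} → p ^ a * x ≡ p ^ b * y → a < b → p ∣ x
    p^a*x≡p^b*y⇒p∣x {a} {b} {x} {y} eq a<b = divides (p ^ (b ∸ suc a) * y) (*-cancelˡ-≡ x _ (p ^ a) {{m^n≢0 p a}} (begin
      p ^ a * x                        ≡⟨ eq ⟩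
      p ^ b * y                        ≡⟨ cong (λ e → p ^ e * y) (m+[n∸m]≡n a<b) ⟨
      p ^ (suc a + (b ∸ suc a)) * y    ≡⟨ cong (_* y) (^-distribˡ-+-* p (suc a) (b ∸ suc a)) ⟩
      p * p ^ a * p ^ (b ∸ suc a) * y  ≡⟨ lemma p (p ^ a) (p ^ (b ∸ suc a)) y ⟩
      p ^ a * (p ^ (b ∸ suc a) * y * p)      ∎))
      where
      open ≡-Reasoning
      lemma : ∀ p a c y → p * a * c * y ≡ a * (c * y * p)
      lemma = ℕ-solve-∀

    p^a*x≡p^b*y⇒a≡b : ∀ {a b x y} → p ^ a * x ≡ p ^ b * y → p ∤ x → p ∤ y → a ≡ b
    p^a*x≡p^b*y⇒a≡b {a} {b} eq p∤x p∤y with <-cmp a b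
    ... | tri< a<b _ _ = contradiction (p^a*x≡p^b*y⇒p∣x eq a<b) p∤x
    ... | tri≈ _ a≡b _ = a≡b
    ... | tri> _ _ b<a = contradiction (p^a*x≡p^b*y⇒p∣x (sym eq) b<a) p∤y

    p^[1+t]*[u*p^a]≤p^t*[u*p^b] : ∀ t u {a b} → a < b → p ^ suc t * (u * p ^ a) ≤ p ^ t * (u * p ^ b)
    p^[1+t]*[u*p^a]≤p^t*[u*p^b] t u {a} {b} a<b = begin
      p ^ suc t * (u * p ^ a)  ≡⟨ regroup (suc t) a ⟩
      u * p ^ (suc t + a)      ≤⟨ *-monoʳ-≤ u (^-monoʳ-≤ p (≤-trans (≤-reflexive (sym (+-suc t a))) (+-monoʳ-≤ t a<b))) ⟩
      u * p ^ (t + b)          ≡⟨ regroup t b ⟨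
      p ^ t * (u * p ^ b)      ∎
      where
      open ≤-Reasoning
      regroup : ∀ s c → p ^ s * (u * p ^ c) ≡ u * p ^ (s + c)
      regroup s c = trans (lemma (p ^ s) u (p ^ c)) (cong (u *_) (sym (^-distribˡ-+-* p s c)))
        where
        lemma : ∀ x u y → x * (u * y) ≡ u * (x * y)
        lemma = ℕ-solve-∀

    ν!-mono-≤ : ∀ {i i′} → i ≤ i′ → ν! i ≤ ν! i′
    ν!-mono-≤ {i} {i′} i≤i′ = begin
      ν! i                                        ≤⟨ m≤m+n (ν! i) _ ⟩
      ν! i + ∑ℕ (i′ ∸ i) (λ k → ν (suc (i + k)))  ≡⟨ ∑ℕ-split i (i′ ∸ i) (λ j → ν (suc j)) ⟨
      ν! (i + (i′ ∸ i))                           ≡⟨ cong ν! (m+[n∸m]≡n i≤i′) ⟩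
      ν! i′                                       ∎
      where open ≤-Reasoning

    module _ (n : ℕ) where

      -- The p-free part of j + 1 times the largest power of p keeping it ≤ n; injective on j < n.
      V : ℕ → ℕ
      V j = p ^ τ n (suc j) * unitPart (suc j)

      V-bounds : ∀ {j} → j < n → 1 ≤ V j × V j ≤ n
      V-bounds {j} j<n = *-mono-≤ (m^n>0 p (τ n (suc j))) (unitPart-pos {suc j} (s≤s z≤n))
                       , ≤-trans (*-monoʳ-≤ (p ^ τ n (suc j)) (unitPart≤ (suc j))) (p^τ*J≤n n (s≤s z≤n) j<n)

      smaller-ν-impossible : ∀ {j k} → k < n → τ n (suc j) ≡ τ n (suc k) → unitPart (suc j) ≡ unitPart (suc k) →
                             ¬ (ν (suc j) < ν (suc k))
      smaller-ν-impossible {j} {k} k<n τJ≡τK uJ≡uK νJ<νK = p^[1+τ]*J≰n n (s≤s z≤n) (begin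
        p ^ suc (τ n J) * J                       ≡⟨ cong (p ^ suc (τ n J) *_) (unitPart*p^ν J) ⟩
        p ^ suc (τ n J) * (unitPart J * p ^ ν J)  ≤⟨ p^[1+t]*[u*p^a]≤p^t*[u*p^b] (τ n J) (unitPart J) νJ<νK ⟩
        p ^ τ n J * (unitPart J * p ^ ν K)        ≡⟨ cong₂ (λ t u → p ^ t * (u * p ^ ν K)) τJ≡τK uJ≡uK ⟩
        p ^ τ n K * (unitPart K * p ^ ν K)        ≡⟨ cong (p ^ τ n K *_) (unitPart*p^ν K) ⟨
        p ^ τ n K * K                             ≤⟨ p^τ*J≤n n (s≤s z≤n) k<n ⟩
        n                                            ∎)
        where
        open ≤-Reasoning
        J = suc j
        K = suc k

      V-injective : ∀ {j k} → j < n → k < n → V j ≡ V k → j ≡ k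
      V-injective {j} {k} j<n k<n Vj≡Vk = suc-injective (begin
        suc j                             ≡⟨ unitPart*p^ν (suc j) ⟩
        unitPart (suc j) * p ^ ν (suc j)  ≡⟨ cong₂ (λ u e → u * p ^ e) u≡ ν≡ ⟩
        unitPart (suc k) * p ^ ν (suc k)  ≡⟨ unitPart*p^ν (suc k) ⟨
        suc k                          ∎)
        where
        open ≡-Reasoning
        τ≡ : τ n (suc j) ≡ τ n (suc k)
        τ≡ = p^a*x≡p^b*y⇒a≡b Vj≡Vk (p∤unitPart {suc j} (s≤s z≤n)) (p∤unitPart {suc k} (s≤s z≤n))
        u≡ : unitPart (suc j) ≡ unitPart (suc k)
        u≡ = *-cancelˡ-≡ _ _ (p ^ τ n (suc j)) {{m^n≢0 p (τ n (suc j))}} (trans Vj≡Vk (cong (λ e → p ^ e * unitPart (suc k)) (sym τ≡)))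
        ν≡ : ν (suc j) ≡ ν (suc k)
        ν≡ with <-cmp (ν (suc j)) (ν (suc k))
        ... | tri< ν< _ _ = contradiction ν< (smaller-ν-impossible k<n τ≡ u≡)
        ... | tri≈ _ ν≡ _ = ν≡
        ... | tri> _ _ ν> = contradiction ν> (smaller-ν-impossible j<n (sym τ≡) (sym u≡))

      ∑min : ℕ → ℕ
      ∑min i = ∑ℕ n (λ t → ⌊ n /p^ suc t ⌋ ⊓ i)

      ∑min≤∑τ : ∀ i → ∑min i ≤ ∑ℕ i (λ j → τ n (suc j))
      ∑min≤∑τ i = begin
        ∑min i                                                        ≤⟨ ∑ℕ-mono n (λ t _ → pointwise t) ⟩
        ∑ℕ n (λ t → ∑ℕ i (λ j → indicator (p ^ suc t * suc j ≤? n)))  ≡⟨ ∑ℕ-comm n i _ ⟩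
        ∑ℕ i (λ j → τ n (suc j))                                      ∎
        where
        open ≤-Reasoning
        pointwise : ∀ t → ⌊ n /p^ suc t ⌋ ⊓ i ≤ count (λ j → p ^ suc t * suc j ≤? n) i
        pointwise t = count-≥ (λ j → p ^ suc t * suc j ≤? n) (m⊓n≤n _ i) below
          where
          Q = p ^ suc t
          below : ∀ j → j < ⌊ n /p^ suc t ⌋ ⊓ i → Q * suc j ≤ n
          below j j< = ≤-trans (*-monoʳ-≤ Q (≤-trans j< (m⊓n≤m _ i)))
                               (≤-trans (≤-reflexive (*-comm Q ⌊ n /p^ suc t ⌋)) (m/n*n≤m n Q {{m^n≢0 p (suc t)}}))

      p^∑min≤C*p^ν! : ∀ i → i ≤ n → p ^ ∑min i ≤ (n C i) * p ^ ν! i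
      p^∑min≤C*p^ν! i i≤n = ≤-trans (^-monoʳ-≤ p (∑min≤∑τ i)) (*-cancelʳ-≤ _ _ (unitPart! i) {{>-nonZero (unitPart!-pos i)}} (begin
        p ^ ∑ℕ i (λ j → τ n (suc j)) * unitPart! i  ≡⟨ cong (_* unitPart! i) (∏-^ p i (λ j → τ n (suc j))) ⟨
        ∏ i (λ j → p ^ τ n (suc j)) * unitPart! i   ≡⟨ ∏-distrib-* i _ _ ⟨
        ∏ i (V)                                     ≡⟨ ∏≡product i (V) ⟩
        product (V ∘ toℕ {i})                       ≤⟨ product-injective≤↓ n (V ∘ toℕ {i}) (λ j → V-bounds (≤-trans (toℕ<n j) i≤n))
                                                           (λ {j} {k} e → toℕ-injective (V-injective (≤-trans (toℕ<n j) i≤n) (≤-trans (toℕ<n k) i≤n) e)) ⟩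
        n ↓ i                                       ≡⟨ ↓≡C*! n i ⟩
        (n C i) * i !                               ≡⟨ cong ((n C i) *_) (!≡p^ν!*unitPart! i) ⟩
        (n C i) * (p ^ ν! i * unitPart! i)          ≡⟨ *-assoc (n C i) _ _ ⟨
        (n C i) * p ^ ν! i * unitPart! i                ∎))
        where open ≤-Reasoning

      deficit : ℕ → ℕ
      deficit i = ∑ℕ n (λ t → ⌊ n /p^ suc t ⌋ ∸ i)

      legendre : ν! n ≤ ∑ℕ n (λ t → ⌊ n /p^ suc t ⌋)
      legendre = begin
        ν! n                                                      ≤⟨ ∑ℕ-mono n (λ j j<n → count-mono-≤ (p^[1+t]∣? (suc j)) j<n) ⟩
        ∑ℕ n (λ j → ∑ℕ n (λ t → indicator (p ^ suc t ∣? suc j)))  ≡⟨ ∑ℕ-comm n n _ ⟩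
        ∑ℕ n (λ t → count (λ j → p ^ suc t ∣? suc j) n)           ≤⟨ ∑ℕ-mono n (λ t _ → count-multiples≤n/Q (p ^ suc t) {{m^n≢0 p (suc t)}} n) ⟩
        ∑ℕ n (λ t → ⌊ n /p^ suc t ⌋)                              ∎
        where open ≤-Reasoning

      ∑⌊n/p^t⌋≡deficit+∑min : ∀ i → ∑ℕ n (λ t → ⌊ n /p^ suc t ⌋) ≡ deficit i + ∑min i
      ∑⌊n/p^t⌋≡deficit+∑min i = trans (∑ℕ-cong n (λ t _ → m≡m∸n+m⊓n _ i)) (∑ℕ-distrib-+ n _ _)
        where
        m≡m∸n+m⊓n : ∀ m n → m ≡ m ∸ n + m ⊓ n
        m≡m∸n+m⊓n m n with ≤-total m n
        ... | inj₁ m≤n = sym (trans (cong₂ _+_ (m≤n⇒m∸n≡0 m≤n) (m≤n⇒m⊓n≡m m≤n)) refl)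
        ... | inj₂ n≤m = sym (trans (cong (λ k → m ∸ n + k) (m≥n⇒m⊓n≡n n≤m)) (m∸n+n≡m n≤m))

      ⌊n/p^[1+t]⌋≤⌊n/p⌋ : ∀ t → ⌊ n /p^ suc t ⌋ ≤ ⌊ n /p^ 1 ⌋
      ⌊n/p^[1+t]⌋≤⌊n/p⌋ t = /-monoʳ-≤ n {{m^n≢0 p (suc t)}} {{m^n≢0 p 1}} (^-monoʳ-≤ p {1} {suc t} (s≤s z≤n))

      ∑min-saturates : ∀ {i} → ⌊ n /p^ 1 ⌋ ≤ i → ∑min i ≡ ∑min ⌊ n /p^ 1 ⌋
      ∑min-saturates {i} q≤i = ∑ℕ-cong n (λ t _ → trans (m≤n⇒m⊓n≡m (≤-trans (⌊n/p^[1+t]⌋≤⌊n/p⌋ t) q≤i))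
                                                        (sym (m≤n⇒m⊓n≡m (⌊n/p^[1+t]⌋≤⌊n/p⌋ t))))


      private
        q = ⌊ n /p^ 1 ⌋
        q≤n : q ≤ n
        q≤n = m/n≤m n (p ^ 1) {{m^n≢0 p 1}}
        2q≤n : 2 * q ≤ n
        2q≤n = ≤-trans (*-monoˡ-≤ q {2} {p ^ 1} (≤-trans (s≤s (s≤s z≤n)) (≤-reflexive (sym (*-identityʳ p)))))
                       (≤-trans (≤-reflexive (*-comm (p ^ 1) q)) (m/n*n≤m n (p ^ 1) {{m^n≢0 p 1}}))

      p^∑min≤p^ν!*C : ∀ {d i} → i ≤ d → p ^ ∑min i ≤ p ^ ν! i * (n C (d ⊓ ⌊ n /p^ 1 ⌋))
      p^∑min≤p^ν!*C {d} {i} i≤d with i ≤? q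
      ... | yes i≤q = begin
        p ^ ∑min i          ≤⟨ p^∑min≤C*p^ν! i (≤-trans i≤q q≤n) ⟩
        (n C i) * p ^ ν! i  ≤⟨ *-monoˡ-≤ (p ^ ν! i) (C-monoʳ-≤-below-half n (⊓-glb i≤d i≤q) 2l≤n) ⟩
        (n C l) * p ^ ν! i  ≡⟨ *-comm (n C l) _ ⟩
        p ^ ν! i * (n C l)  ∎
        where
        open ≤-Reasoning
        l = d ⊓ q
        2l≤n : 2 * l ≤ n
        2l≤n = ≤-trans (*-monoʳ-≤ 2 (m⊓n≤n d q)) 2q≤n
      ... | no  i≰q = begin
        p ^ ∑min i          ≡⟨ cong (p ^_) (∑min-saturates q≤i) ⟩
        p ^ ∑min q          ≤⟨ p^∑min≤C*p^ν! q q≤n ⟩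
        (n C q) * p ^ ν! q  ≤⟨ *-monoʳ-≤ (n C q) (^-monoʳ-≤ p (ν!-mono-≤ q≤i)) ⟩
        (n C q) * p ^ ν! i  ≡⟨ *-comm (n C q) _ ⟩
        p ^ ν! i * (n C q)  ≡⟨ cong (λ m → p ^ ν! i * (n C m)) (m≥n⇒m⊓n≡n (≤-trans q≤i i≤d)) ⟨
        p ^ ν! i * (n C l)  ∎
        where
        open ≤-Reasoning
        l = d ⊓ q
        q≤i : q ≤ i
        q≤i = <⇒≤ (≰⇒> i≰q)

      p^u≤p^[ν!+deficit]*C : ∀ {d i u} → i ≤ d → p ^ u ∣ n ! → p ^ u ≤ p ^ (ν! i + deficit i) * (n C (d ⊓ ⌊ n /p^ 1 ⌋))
      p^u≤p^[ν!+deficit]*C {d} {i} {u} i≤d p^u∣n! = begin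
        p ^ u                                 ≤⟨ ^-monoʳ-≤ p u≤ ⟩
        p ^ (deficit i + ∑min i)              ≡⟨ ^-distribˡ-+-* p (deficit i) (∑min i) ⟩
        p ^ deficit i * p ^ ∑min i            ≤⟨ *-monoʳ-≤ (p ^ deficit i) (p^∑min≤p^ν!*C i≤d) ⟩
        p ^ deficit i * (p ^ ν! i * (n C l))  ≡⟨ lemma (p ^ deficit i) (p ^ ν! i) (n C l) ⟩
        p ^ ν! i * p ^ deficit i * (n C l)    ≡⟨ cong (_* (n C l)) (^-distribˡ-+-* p (ν! i) (deficit i)) ⟨
        p ^ (ν! i + deficit i) * (n C l)      ∎
        where
        open ≤-Reasoning
        l = d ⊓ ⌊ n /p^ 1 ⌋
        u≤ : u ≤ deficit i + ∑min i
        u≤ = ≤-trans (p^u∣n!⇒u≤ν! n u p^u∣n!) (≤-trans legendre (≤-reflexive (∑⌊n/p^t⌋≡deficit+∑min i)))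
        lemma : ∀ a b c → a * (b * c) ≡ b * a * c
        lemma = ℕ-solve-∀

  -- Orders of the sums over a residue class

  module _ where
    open import Data.Integer using (_+_; _*_; _^_)
    open import Data.Integer.Divisibility.Signed using (_∣_; divides; ∣ᵤ⇒∣; ∣⇒∣ᵤ; ∣-trans; *-cancelʳ-∣)
    open import Data.Integer.Tactic.RingSolver using (solve-∀)
    open import Data.Nat.DivMod using (m/n*n≤m; /-congʳ)
    open import Data.Nat.Combinatorics using (_C_)

    p^M∣x⇒M≤ord : ∀ {x M e} → + (p ℕ.^ M) ∣ x → IsOrd p x e → M ≤ e
    p^M∣x⇒M≤ord {x} {M} {e} p^M∣x (_ , p^[1+e]∤x) with M ℕ.≤? e
    ... | yes M≤e = M≤e
    ... | no  M≰e = contradiction (ℕ.∣-trans (p^-mono-∣ (ℕ.≰⇒> M≰e)) (∣⇒∣ᵤ p^M∣x)) p^[1+e]∤x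

    ord-split : ∀ {x e} → IsOrd p x e → ∃ λ a → x ≡ a * + (p ℕ.^ e) × ¬ (+ p ∣ a)
    ord-split {x} {e} (p^e∣x , p^[1+e]∤x) with ∣ᵤ⇒∣ {+ (p ℕ.^ e)} {x} p^e∣x
    ... | divides a x≡a*p^e = a , x≡a*p^e , p∤a
      where
      p∤a : ¬ (+ p ∣ a)
      p∤a (divides b a≡b*p) = p^[1+e]∤x (∣⇒∣ᵤ (divides b (begin
        x                        ≡⟨ x≡a*p^e ⟩
        a * + (p ℕ.^ e)          ≡⟨ cong (_* + (p ℕ.^ e)) a≡b*p ⟩
        b * + p * + (p ℕ.^ e)    ≡⟨ ℤ.*-assoc b (+ p) _ ⟩
        b * (+ p * + (p ℕ.^ e))  ≡⟨ cong (b *_) (ℤ.pos-* p (p ℕ.^ e)) ⟨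
        b * + (p ℕ.^ suc e)        ∎)))
        where open ≡-Reasoning

    ord-* : ∀ {x y u v e} → IsOrd p x v → IsOrd p y e → + (p ℕ.^ u) ∣ x * y → u ≤ v ℕ.+ e
    ord-* {x} {y} {u} {v} {e} ord-x ord-y p^u∣xy with u ℕ.≤? v ℕ.+ e | ord-split {x} {v} ord-x | ord-split {y} {e} ord-y
    ... | yes u≤v+e | _ | _ = u≤v+e
    ... | no  u≰v+e | a , refl , p∤a | b , refl , p∤b =
      ⊥-elim ([ p∤a , p∤b ]′ (euclidsLemmaℤ {a} {b} (*-cancelʳ-∣ (+ (p ℕ.^ (v ℕ.+ e))) {{ℕ.m^n≢0 p (v ℕ.+ e)}} p*P∣ab*P)))
      where
      P = + (p ℕ.^ (v ℕ.+ e))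
      regroup : a * + (p ℕ.^ v) * (b * + (p ℕ.^ e)) ≡ a * b * P
      regroup = trans (lemma a b (+ (p ℕ.^ v)) (+ (p ℕ.^ e)))
                      (cong (a * b *_) (trans (sym (ℤ.pos-* (p ℕ.^ v) (p ℕ.^ e))) (cong +_ (sym (ℕ.^-distribˡ-+-* p v e)))))
        where
        lemma : ∀ a b x y → a * x * (b * y) ≡ a * b * (x * y)
        lemma = solve-∀
      p*P∣ab*P : + p * P ∣ a * b * P
      p*P∣ab*P = ∣-respʳ regroup (∣-trans p*P∣p^u p^u∣xy)
        where
        p*P∣p^u : + p * P ∣ + (p ℕ.^ u)
        p*P∣p^u = subst (_∣ + (p ℕ.^ u)) (ℤ.pos-* p (p ℕ.^ (v ℕ.+ e)))
                    (∣ᵤ⇒∣ {+ (p ℕ.^ suc (v ℕ.+ e))} {+ (p ℕ.^ u)} (p^-mono-∣ (ℕ.≰⇒> u≰v+e)))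

    p^[ν!+deficit]∣stirlingFalling : ∀ n i y → + (p ℕ.^ (ν! i ℕ.+ deficit n i)) ∣ stirlingFalling n i y
    p^[ν!+deficit]∣stirlingFalling n i y =
      ∣-trans (∣ᵤ⇒∣ (p^-mono-∣ (ℕ.+-monoʳ-≤ (ν! i) deficit≤excess))) (p^∣stirlingFalling n n i y)
      where
      ⌊n/p^t⌋≤multiplesIn : ∀ t → ⌊ n /p^ t ⌋ ≤ multiplesIn y (p ℕ.^ t) n
      ⌊n/p^t⌋≤multiplesIn t = c*Q≤n⇒c≤multiplesIn (ℕ.m^n>0 p t) ⌊ n /p^ t ⌋ y n (m/n*n≤m n (p ℕ.^ t) {{ℕ.m^n≢0 p t}})
      deficit≤excess : deficit n i ≤ excess n y n i
      deficit≤excess = ∑ℕ-mono n (λ t _ → ℕ.∸-monoˡ-≤ i (⌊n/p^t⌋≤multiplesIn (suc t)))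

    part1 : ∀ n m (a r : ℤ) (e u v : ℕ) →
            IsOrd p (sumRes (p ℕ.∸ 1) r n (λ k → + (stir1 n k ℕ.* stir2 k m) * a ^ k)) e →
            IsOrd p (+ (n ℕ.!)) u → IsOrd p (+ (m ℕ.!)) v → u ≤ e ℕ.+ v
    part1 n m a r e u v ord-S ord-n! ord-m! =
      subst (u ≤_) (ℕ.+-comm v e) (ord-* {+ (m ℕ.!)} {S} {u} {v} {e} ord-m! ord-S (∣-respʳ m!S≡ p^u∣m!S))
      where
      c : ℕ → ℤ
      c k = + (stir1 n k ℕ.* stir2 k m)
      S = sumRes p-1 r n (λ k → c k * a ^ k)
      p^u∣n! : + (p ℕ.^ u) ∣ + (n ℕ.!)
      p^u∣n! = ∣ᵤ⇒∣ (proj₁ ord-n!)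
      p^u∣P : ∀ y → + (p ℕ.^ u) ∣ ∑ (suc n) (λ k → + (m ℕ.!) * c k * y ^ k)
      p^u∣P y = ∣-trans p^u∣n! (∣-respʳ (trans (sym (*-distribˡ-∑ (suc n) (+ (m ℕ.!)) (λ k → c k * y ^ k)))
                                                      (∑-cong (suc n) (λ k _ → sym (ℤ.*-assoc (+ (m ℕ.!)) (c k) (y ^ k)))))
                                        (n!∣m!∑stirling n m y))
      p^u∣m!S : + (p ℕ.^ u) ∣ sumRes p-1 r n (λ k → + (m ℕ.!) * c k * a ^ k)
      p^u∣m!S = residue-filter (λ k → + (m ℕ.!) * c k) n u p^u∣P a r
      m!S≡ : sumRes p-1 r n (λ k → + (m ℕ.!) * c k * a ^ k) ≡ + (m ℕ.!) * S
      m!S≡ = trans (sumRes-cong p-1 r n (λ k → ℤ.*-assoc (+ (m ℕ.!)) (c k) (a ^ k))) (sumRes-* p-1 r n (+ (m ℕ.!)) (λ k → c k * a ^ k))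

    part2 : ∀ n (f : Poly) (a r : ℤ) (e u : ℕ) →
            IsOrd p (sumRes (p ℕ.∸ 1) r n (λ k → + (stir1 n k) * eval f (+ k) * a ^ k)) e →
            IsOrd p (+ (n ℕ.!)) u → p ℕ.^ u ≤ p ℕ.^ e ℕ.* (n C (deg f ℕ.⊓ quot n p))
    part2 n f a r e u ord-S ord-n! with argmin (λ i → ν! i ℕ.+ deficit n i) (deg f)
    ... | i₀ , i₀≤d , i₀-min = begin
      p ℕ.^ u                                       ≤⟨ p^u≤p^[ν!+deficit]*C n {u = u} i₀≤d (proj₁ ord-n!) ⟩
      p ℕ.^ W i₀ ℕ.* (n C (deg f ℕ.⊓ ⌊ n /p^ 1 ⌋))  ≤⟨ ℕ.*-monoˡ-≤ _ (ℕ.^-monoʳ-≤ p W≤e) ⟩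
      p ℕ.^ e ℕ.* (n C (deg f ℕ.⊓ ⌊ n /p^ 1 ⌋))     ≡⟨ cong (λ q → p ℕ.^ e ℕ.* (n C (deg f ℕ.⊓ q))) (/-congʳ {m = n} {{ℕ.m^n≢0 p 1}} (ℕ.*-identityʳ p)) ⟩
      p ℕ.^ e ℕ.* (n C (deg f ℕ.⊓ quot n p))        ∎
      where
      open ℕ.≤-Reasoning
      W : ℕ → ℕ
      W i = ν! i ℕ.+ deficit n i
      p^W∣basis : ∀ i → i ≤ deg f → ∀ y → + (p ℕ.^ W i₀) ∣ stirlingFalling n i y
      p^W∣basis i i≤d y = ∣-trans (∣ᵤ⇒∣ (p^-mono-∣ (i₀-min i i≤d))) (p^[ν!+deficit]∣stirlingFalling n i y)
      W≤e : W i₀ ≤ e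
      W≤e = p^M∣x⇒M≤ord (residue-filter (λ k → + (stir1 n k) * eval f (+ k)) n (W i₀)
                           (∣-∑-stirling₁-FallingSpan n p^W∣basis (eval∈FallingSpan f)) a r) ord-S


open import Data.Nat using (ℕ; suc; _!; _≤_; _+_; _*_; _^_; _∸_; _⊓_)
open import Data.Nat.Combinatorics using (_C_)

theorem1p2 : (p n m : ℕ) → Prime p → 1 ≤ n → 1 ≤ m →
    ((a r : ℤ) (e u v : ℕ) →
      IsOrd p (sumRes (p ∸ 1) r n (λ k → (+ (stir1 n k * stir2 k m)) ℤ.* (a ℤ.^ k))) e →
      IsOrd p (+ (n !)) u → IsOrd p (+ (m !)) v → u ≤ e + v)
    ×
    ((f : Poly) → NonZeroPoly f → (a r : ℤ) (e u : ℕ) →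
      IsOrd p (sumRes (p ∸ 1) r n (λ k → (+ (stir1 n k)) ℤ.* eval f (+ k) ℤ.* (a ℤ.^ k))) e →
      IsOrd p (+ (n !)) u →
      p ^ u ≤ p ^ e * (n C (deg f ⊓ quot n p)))
theorem1p2 zero           n m p-prime _ _ = contradiction p-prime ¬prime[0]
theorem1p2 (suc zero)     n m p-prime _ _ = contradiction p-prime ¬prime[1]
theorem1p2 (suc (suc p₀)) n m p-prime _ _ = part1 p₀ p-prime n m , λ f _ → part2 p₀ p-prime n f
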